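{- Let $G$ be a finite simple graph. If $G$ contains $K^{*}_{2,3}$ as an induced minor, then $G$ contains a 3-path configuration as an induced subgraph.
   Context: $K^{*}_{2,3}$ is the graph obtained from $K_{2,3}$ by subdividing every edge once, i.e. the graph with two degree-3 vertices joined by three internally disjoint paths of length four. A graph $H$ is an induced minor of $G$ if $H$ can be obtained from $G$ by repeatedly deleting vertices and contracting edges. Lengths of paths are numbers of edges; all paths are chordless. A theta is a graph made of three internally vertex-disjoint chordless paths $P_1=a\dots b$, $P_2=a\dots b$, $P_3=a\dots b$, each of length at least two, with no edges between the paths except the three edges incident to $a$ and the three edges incident to $b$. A prism is a graph made of three vertex-disjoint chordless paths $P_1=a_1\dots b_1$, $P_2=a_2\dots b_2$, $P_3=a_3\dots b_3$ such that $\{a_1,a_2,a_3\}$ and $\{b_1,b_2,b_3\}$ are triangles, no edges exist between the paths except those of the two triangles, and either all three paths have length at least $1$, or one of them has length $0$ and each of the other two has length at least $2$. A pyramid is a graph made of three chordless paths $P_1=a\dots b_1$, $P_2=a\dots b_2$, $P_3=a\dots b_3$, each of length at least one and two of them of length at least two, vertex-disjoint except at $a$, such that $\{b_1,b_2,b_3\}$ is a triangle and no edges exist between the paths except those of the triangle and the three edges incident to $a$. A 3-path configuration (3PC) is a theta, a prism or a pyramid. -}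

module Defs where

open import Data.Nat using (ℕ; zero; suc; _≤_; _∸_)
open import Data.Fin using (Fin; toℕ)
open import Data.Bool using (Bool; true; false; _∨_)
open import Data.Bool.Properties using (∨-comm)
open import Data.List using (List; []; _∷_; length; head; last)
open import Data.List.Membership.Propositional using (_∈_)
open import Data.List.Relation.Unary.Unique.Propositional using (Unique)
open import Data.Maybe using (just)
open import Data.Product using (Σ; ∃; ∃-syntax; _×_; _,_)
open import Data.Sum using (_⊎_)
open import Data.Empty using (⊥)
open import Relation.Nullary using (¬_)
open import Relation.Binary.PropositionalEquality using (_≡_; _≢_; refl)
open import Relation.Binary.Construct.Closure.ReflexiveTransitive using (Star)
open import Function.Bundles using (_⇔_)

record Graph : Set where
  field
    n      : ℕ
    adj    : Fin n → Fin n → Bool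
    sym    : ∀ u v → adj u v ≡ adj v u
    irrefl : ∀ u → adj u u ≡ false
open Graph public

-- H is (isomorphic to) an induced subgraph of G: an injective map
-- V(H) → V(G) preserving and reflecting adjacency.
-- (This is exactly "obtained from G by deleting vertices", up to iso.)

record InducedSubgraph (H G : Graph) : Set where
  field
    emb      : Fin (n H) → Fin (n G)
    emb-inj  : ∀ x y → emb x ≡ emb y → x ≡ y
    emb-adj  : ∀ x y → adj H x y ≡ adj G (emb x) (emb y)

-- H is obtained from G by contracting the edge uv (up to relabelling):
-- f : V(G) → V(H) is onto, identifies exactly u and v, and two distinct
-- vertices of H are adjacent iff some edge of G joins their preimages.

record Contraction (G H : Graph) : Set where
  field
    f        : Fin (n G) → Fin (n H)
    u v      : Fin (n G)
    u≢v      : u ≢ v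
    uv-edge  : adj G u v ≡ true
    fu≡fv    : f u ≡ f v
    f-onto   : ∀ a → ∃[ x ] f x ≡ a
    f-fibres : ∀ x y → f x ≡ f y →
               x ≡ y ⊎ (x ≡ u × y ≡ v) ⊎ (x ≡ v × y ≡ u)
    f-adj    : ∀ a b → a ≢ b →
               (adj H a b ≡ true ⇔
                (∃[ x ] ∃[ y ] (f x ≡ a × f y ≡ b × adj G x y ≡ true)))

-- One step: a vertex deletion (possibly several, or none = isomorphism)
-- or an edge contraction.
data MinorStep : Graph → Graph → Set where
  delete   : ∀ {G H} → InducedSubgraph H G → MinorStep G H
  contract : ∀ {G H} → Contraction G H → MinorStep G H

InducedMinor : Graph → Graph → Set
InducedMinor H G = Star MinorStep G H

-- K*_{2,3}: vertices 0 = a, 1 = b; paths a-2-3-4-b, a-5-6-7-b, a-8-9-10-b.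

isE : ℕ → ℕ → Bool
isE 0 2  = true
isE 2 3  = true
isE 3 4  = true
isE 4 1  = true
isE 0 5  = true
isE 5 6  = true
isE 6 7  = true
isE 7 1  = true
isE 0 8  = true
isE 8 9  = true
isE 9 10 = true
isE 10 1 = true
isE _ _  = false

K23*adj : Fin 11 → Fin 11 → Bool
K23*adj i j = isE (toℕ i) (toℕ j) ∨ isE (toℕ j) (toℕ i)

K23*irrefl : ∀ u → K23*adj u u ≡ false
K23*irrefl Fin.zero = refl
K23*irrefl (Fin.suc Fin.zero) = refl
K23*irrefl (Fin.suc (Fin.suc Fin.zero)) = refl
K23*irrefl (Fin.suc (Fin.suc (Fin.suc Fin.zero))) = refl
K23*irrefl (Fin.suc (Fin.suc (Fin.suc (Fin.suc Fin.zero)))) = refl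
K23*irrefl (Fin.suc (Fin.suc (Fin.suc (Fin.suc (Fin.suc Fin.zero))))) = refl
K23*irrefl (Fin.suc (Fin.suc (Fin.suc (Fin.suc (Fin.suc (Fin.suc Fin.zero)))))) = refl
K23*irrefl (Fin.suc (Fin.suc (Fin.suc (Fin.suc (Fin.suc (Fin.suc (Fin.suc Fin.zero))))))) = refl
K23*irrefl (Fin.suc (Fin.suc (Fin.suc (Fin.suc (Fin.suc (Fin.suc (Fin.suc (Fin.suc Fin.zero)))))))) = refl
K23*irrefl (Fin.suc (Fin.suc (Fin.suc (Fin.suc (Fin.suc (Fin.suc (Fin.suc (Fin.suc (Fin.suc Fin.zero))))))))) = refl
K23*irrefl (Fin.suc (Fin.suc (Fin.suc (Fin.suc (Fin.suc (Fin.suc (Fin.suc (Fin.suc (Fin.suc (Fin.suc Fin.zero)))))))))) = refl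

K23* : Graph
K23* = record
  { n      = 11
  ; adj    = K23*adj
  ; sym    = λ i j → ∨-comm (isE (toℕ i) (toℕ j)) (isE (toℕ j) (toℕ i))
  ; irrefl = K23*irrefl
  }

data Link {A : Set} : List A → A → A → Set where
  here  : ∀ {x y xs} → Link (x ∷ y ∷ xs) x y
  there : ∀ {x xs u v} → Link xs u v → Link (x ∷ xs) u v

PathEdge : {A : Set} → List A → A → A → Set
PathEdge p u v = Link p u v ⊎ Link p v u

PathFromTo : ∀ {m} → List (Fin m) → Fin m → Fin m → Set
PathFromTo p a b = Unique p × head p ≡ just a × last p ≡ just b

len : ∀ {A : Set} → List A → ℕ
len p = length p ∸ 1

TriEdge : ∀ {m} → (Fin 3 → Fin m) → Fin m → Fin m → Set
TriEdge c u v = ∃[ i ] ∃[ j ] (i ≢ j × u ≡ c i × v ≡ c j)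

record IsTheta (H : Graph) : Set where
  field
    a b      : Fin (n H)
    P        : Fin 3 → List (Fin (n H))
    paths    : ∀ i → PathFromTo (P i) a b
    long     : ∀ i → 2 ≤ len (P i)
    disjoint : ∀ i j x → i ≢ j → x ∈ P i → x ∈ P j → x ≡ a ⊎ x ≡ b
    cover    : ∀ x → ∃[ i ] x ∈ P i
    edges    : ∀ x y → (adj H x y ≡ true ⇔ (∃[ i ] PathEdge (P i) x y))

record IsPrism (H : Graph) : Set where
  field
    a b      : Fin 3 → Fin (n H)
    P        : Fin 3 → List (Fin (n H))
    paths    : ∀ i → PathFromTo (P i) (a i) (b i)
    lengths  : (∀ i → 1 ≤ len (P i))
               ⊎ (∃[ i ] (len (P i) ≡ 0 × (∀ j → j ≢ i → 2 ≤ len (P j))))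
    disjoint : ∀ i j x → i ≢ j → x ∈ P i → x ∈ P j → ⊥
    cover    : ∀ x → ∃[ i ] x ∈ P i
    edges    : ∀ x y → (adj H x y ≡ true ⇔
                        ((∃[ i ] PathEdge (P i) x y) ⊎ TriEdge a x y ⊎ TriEdge b x y))

record IsPyramid (H : Graph) : Set where
  field
    a        : Fin (n H)
    b        : Fin 3 → Fin (n H)
    P        : Fin 3 → List (Fin (n H))
    paths    : ∀ i → PathFromTo (P i) a (b i)
    long1    : ∀ i → 1 ≤ len (P i)
    long2    : ∃[ i ] ∃[ j ] (i ≢ j × 2 ≤ len (P i) × 2 ≤ len (P j))
    disjoint : ∀ i j x → i ≢ j → x ∈ P i → x ∈ P j → x ≡ a
    cover    : ∀ x → ∃[ i ] x ∈ P i
    edges    : ∀ x y → (adj H x y ≡ true ⇔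
                        ((∃[ i ] PathEdge (P i) x y) ⊎ TriEdge b x y))

Is3PC : Graph → Set
Is3PC H = IsTheta H ⊎ IsPrism H ⊎ IsPyramid H

Contains3PC : Graph → Set
Contains3PC G = ∃[ H ] (InducedSubgraph H G × Is3PC H)

-- A model of K*₂,₃ in G consists of connected sets A, B (for the two
-- vertices of degree three) and Y₀, Y₁, Y₂ (for the interiors of the three
-- paths) with the adjacencies of K*₂,₃; since each interior is a path of
-- length two, no vertex of Y i has neighbours in both A and B and no edge of
-- Y i joins a neighbour of A to a neighbour of B.  Such a model survives
-- undoing vertex deletions and edge contractions, so G has one.  In each Y i an
-- induced path joins the only vertex touching A to the only vertex touching
-- B, and it has length at least two.  Three vertices with neighbours in a
-- connected set X are joined through X by a claw or by a triangle with three
-- legs; doing this in A and in B and concatenating with the paths in the Y i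
-- gives a theta (two claws), a pyramid (a claw and a triangle) or a prism
-- (two triangles).

module Submission where

open import Data.Bool using (true)
open import Data.Bool.Properties using () renaming (_≟_ to _≟ᵇ_)
open import Data.Empty using (⊥; ⊥-elim)
open import Data.Fin using (Fin; suc; #_; _↑ʳ_; combine)
open import Data.Fin.Patterns using (0F; 1F; 2F)
open import Data.Fin.Properties using (_≟_)
import Data.Fin.Properties as Fin
open import Data.List
  using (List; []; _∷_; _++_; _∷ʳ_; [_]; head; last; reverse; length; map; lookup; deduplicate)
open import Data.List.Membership.Propositional using (_∈_; _∉_; lose)
open import Data.List.Membership.Propositional.Properties
  using (∈-++⁺ˡ; ∈-++⁺ʳ; ∈-++⁻; ∈-lookup; ∈-map⁺; ∈-deduplicate⁺; ∈-deduplicate⁻)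
open import Data.List.Properties
  using ( ++-assoc; length-++; length-map; length-reverse; map-∘; map-id-local; head-map; last-map
        ; unfold-reverse; reverse-++; reverse-involutive)
open import Data.List.Relation.Binary.Subset.Propositional using (_⊆_)
open import Data.List.Relation.Unary.All as All using (All; []; _∷_)
import Data.List.Relation.Unary.All.Properties as All
open import Data.List.Relation.Unary.Any as Any using (Any; here; there; any?)
import Data.List.Relation.Unary.Any.Properties as Any
open import Data.List.Relation.Unary.Unique.Propositional using (Unique; []; _∷_)
import Data.List.Relation.Unary.Unique.Propositional.Properties as Unique
import Data.List.Relation.Unary.Unique.DecPropositional.Properties as Deduplicate
open import Data.Maybe as Maybe using (just)
open import Data.Nat using (_≤_; _∸_; s≤s; z≤n)
open import Data.Nat.Properties using (+-monoʳ-≤; m≤n+m; ≤-trans; ∸-monoˡ-≤)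
open import Data.Product as Product using (Σ-syntax; ∃-syntax; _×_; _,_; proj₁; proj₂)
open import Data.Sum as Sum using (_⊎_; inj₁; inj₂; [_,_]′)
open import Function using (_∘′_; id)
open import Function.Bundles using (Equivalence; mk⇔)
open import Relation.Binary.Construct.Closure.ReflexiveTransitive as Star using (Star; ε; _◅_; _◅◅_)
open import Relation.Binary.PropositionalEquality using (_≡_; _≢_; refl; sym; trans; cong; subst; subst₂)
open import Relation.Nullary using (¬_; ¬?; Dec; yes; no)
open import Relation.Nullary.Decidable using (_⊎-dec_; _×-dec_; _→-dec_; from-yes)
open import Relation.Unary using (Decidable)

open import Defs hiding (sym)

module _ {A : Set} where

  private variable
    a b s x y : A
    xs ys : List A

  link-∈ˡ : Link xs x y → x ∈ xs
  link-∈ˡ here      = here refl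
  link-∈ˡ (there l) = there (link-∈ˡ l)

  link-∈ʳ : Link xs x y → y ∈ xs
  link-∈ʳ here      = there (here refl)
  link-∈ʳ (there l) = there (link-∈ʳ l)

  pathEdge-∈ˡ : PathEdge xs x y → x ∈ xs
  pathEdge-∈ˡ = [ link-∈ˡ , link-∈ʳ ]′

  pathEdge-∈ʳ : PathEdge xs x y → y ∈ xs
  pathEdge-∈ʳ = [ link-∈ʳ , link-∈ˡ ]′

  link-++⁺ˡ : Link xs x y → Link (xs ++ ys) x y
  link-++⁺ˡ here      = here
  link-++⁺ˡ (there l) = there (link-++⁺ˡ l)

  link-++⁺ʳ : ∀ xs → Link ys x y → Link (xs ++ ys) x y
  link-++⁺ʳ []       l = l
  link-++⁺ʳ (_ ∷ xs) l = there (link-++⁺ʳ xs l)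

  link-∷ʳ⁺ : ∀ xs → Link (xs ∷ʳ s) x y → Link (xs ++ s ∷ ys) x y
  link-∷ʳ⁺ {s = s} {ys = ys} xs l =
    subst (λ p → Link p _ _) (++-assoc xs [ s ] ys) (link-++⁺ˡ l)

  link-++-∷⁻ : ∀ xs → Link (xs ++ s ∷ ys) x y → Link (xs ∷ʳ s) x y ⊎ Link (s ∷ ys) x y
  link-++-∷⁻ []               l         = inj₂ l
  link-++-∷⁻ (_ ∷ [])         here      = inj₁ here
  link-++-∷⁻ (_ ∷ [])         (there l) = inj₂ l
  link-++-∷⁻ (_ ∷ _ ∷ _)      here      = inj₁ here
  link-++-∷⁻ (_ ∷ xs@(_ ∷ _)) (there l) = Sum.map₁ there (link-++-∷⁻ xs l)

  link-map⁺ : ∀ {B : Set} (f : A → B) → Link xs x y → Link (map f xs) (f x) (f y)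
  link-map⁺ f here      = here
  link-map⁺ f (there l) = there (link-map⁺ f l)

  link-∷ʳ-∷ʳ : ∀ xs → Link (xs ∷ʳ x ∷ʳ y) x y
  link-∷ʳ-∷ʳ []       = here
  link-∷ʳ-∷ʳ (_ ∷ xs) = there (link-∷ʳ-∷ʳ xs)

  link-reverse : Link xs x y → Link (reverse xs) y x
  link-reverse {xs = x ∷ y ∷ zs} here
    rewrite unfold-reverse x (y ∷ zs) | unfold-reverse y zs = link-∷ʳ-∷ʳ (reverse zs)
  link-reverse {xs = z ∷ zs} (there l)
    rewrite unfold-reverse z zs = link-++⁺ˡ (link-reverse l)

  link-reverse⁻ : Link (reverse xs) x y → Link xs y x
  link-reverse⁻ {xs = xs} l = subst (λ p → Link p _ _) (reverse-involutive xs) (link-reverse l)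

  ∈-∷ʳ⁻ : ∀ xs → x ∈ xs ∷ʳ s → x ∈ xs ⊎ x ≡ s
  ∈-∷ʳ⁻ xs m = Sum.map₂ (λ { (here eq) → eq }) (∈-++⁻ xs m)

  ∈-∷ʳ⁺ : ∀ xs → x ∈ xs ∷ʳ s → x ∈ xs ++ s ∷ ys
  ∈-∷ʳ⁺ xs m = [ ∈-++⁺ˡ , (λ { refl → ∈-++⁺ʳ xs (here refl) }) ]′ (∈-∷ʳ⁻ xs m)

  ∈-++-∷⁻ : ∀ xs → x ∈ xs ++ s ∷ ys → x ∈ xs ∷ʳ s ⊎ x ∈ s ∷ ys
  ∈-++-∷⁻ xs m = Sum.map₁ ∈-++⁺ˡ (∈-++⁻ xs m)

  ∈-reverse⁻ : x ∈ reverse xs → x ∈ xs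
  ∈-reverse⁻ = Any.reverse⁻

  reverse-∷ʳ : ∀ xs → reverse (xs ∷ʳ x) ≡ x ∷ reverse xs
  reverse-∷ʳ {x = x} xs = reverse-++ xs [ x ]

  head-∈ : head xs ≡ just a → a ∈ xs
  head-∈ {xs = _ ∷ _} refl = here refl

  last-∈ : last xs ≡ just b → b ∈ xs
  last-∈ {xs = _ ∷ []}     refl = here refl
  last-∈ {xs = _ ∷ y ∷ ys} eq  = there (last-∈ {xs = y ∷ ys} eq)

  head-just : head xs ≡ just a → ∃[ ws ] xs ≡ a ∷ ws
  head-just {xs = x ∷ xs} refl = xs , refl

  last-just : ∀ xs → last xs ≡ just b → ∃[ ws ] xs ≡ ws ∷ʳ b
  last-just (_ ∷ [])     refl = [] , refl
  last-just (x ∷ y ∷ ys) eq with ws , eq′ ← last-just (y ∷ ys) eq = x ∷ ws , cong (x ∷_) eq′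

  last-∷ʳ : ∀ xs → last (xs ∷ʳ x) ≡ just x
  last-∷ʳ []           = refl
  last-∷ʳ (_ ∷ [])     = refl
  last-∷ʳ (_ ∷ _ ∷ xs) = last-∷ʳ (_ ∷ xs)

  last-++-∷ : ∀ xs → last (xs ++ s ∷ ys) ≡ last (s ∷ ys)
  last-++-∷ []           = refl
  last-++-∷ (_ ∷ [])     = refl
  last-++-∷ (_ ∷ _ ∷ xs) = last-++-∷ (_ ∷ xs)

  last-suffix : ∀ {zs} xs → zs ≡ xs ++ s ∷ ys → last zs ≡ just b → last (s ∷ ys) ≡ just b
  last-suffix xs refl l = trans (sym (last-++-∷ xs)) l

  head-∷ʳ : ∀ xs → head (xs ∷ʳ s) ≡ head (xs ++ s ∷ ys)
  head-∷ʳ []      = refl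
  head-∷ʳ (_ ∷ _) = refl

  last-reverse : head xs ≡ just a → last (reverse xs) ≡ just a
  last-reverse {xs = x ∷ xs} refl rewrite unfold-reverse x xs = last-∷ʳ (reverse xs)

  head-reverse : ∀ xs → last xs ≡ just b → head (reverse xs) ≡ just b
  head-reverse xs eq with ws , refl ← last-just xs eq = cong head (reverse-∷ʳ ws)

  unique-++⁻ˡ : ∀ xs → Unique (xs ++ ys) → Unique xs
  unique-++⁻ˡ []       _        = []
  unique-++⁻ˡ (_ ∷ xs) (px ∷ u) = All.++⁻ˡ xs px ∷ unique-++⁻ˡ xs u

  unique-++⁻ʳ : ∀ xs → Unique (xs ++ ys) → Unique ys
  unique-++⁻ʳ []       u       = u
  unique-++⁻ʳ (_ ∷ xs) (_ ∷ u) = unique-++⁻ʳ xs u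

  unique-++-disjoint : ∀ xs → Unique (xs ++ ys) → x ∈ xs → x ∉ ys
  unique-++-disjoint (_ ∷ xs) (px ∷ _) (here refl) m = All.lookup (All.++⁻ʳ xs px) m refl
  unique-++-disjoint (_ ∷ xs) (_ ∷ u)  (there mx)  m = unique-++-disjoint xs u mx m

  unique-∷⁻ : Unique (x ∷ xs) → x ∉ xs
  unique-∷⁻ (px ∷ _) m = All.lookup px m refl

  unique-∷ʳ⁻ : ∀ xs → Unique (xs ++ s ∷ ys) → Unique (xs ∷ʳ s)
  unique-∷ʳ⁻ {s = s} {ys = ys} xs u =
    unique-++⁻ˡ (xs ∷ʳ s) (subst Unique (sym (++-assoc xs [ s ] ys)) u)

  unique-∷ʳ-meet : ∀ xs → Unique (xs ++ s ∷ ys) → x ∈ xs ∷ʳ s → x ∈ s ∷ ys → x ≡ s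
  unique-∷ʳ-meet xs u m (here eq)  = eq
  unique-∷ʳ-meet {s = s} {ys = ys} xs u m (there m′) =
    ⊥-elim (unique-++-disjoint (xs ∷ʳ s) (subst Unique (sym (++-assoc xs [ s ] ys)) u) m m′)

  unique-reverse : Unique xs → Unique (reverse xs)
  unique-reverse [] = []
  unique-reverse {xs = x ∷ xs} (px ∷ u) rewrite unfold-reverse x xs =
    Unique.++⁺ (unique-reverse u) ([] ∷ [])
      λ { (m , here refl) → All.lookup px (∈-reverse⁻ m) refl }

  lookup-injective : Unique xs → ∀ {i j} → lookup xs i ≡ lookup xs j → i ≡ j
  lookup-injective {xs = _ ∷ _}  _        {0F}    {0F}    _  = refl
  lookup-injective {xs = _ ∷ xs} (px ∷ _) {0F}    {suc j} eq = ⊥-elim (All.lookup px (∈-lookup j) eq)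
  lookup-injective {xs = _ ∷ xs} (px ∷ _) {suc i} {0F}    eq = ⊥-elim (All.lookup px (∈-lookup i) (sym eq))
  lookup-injective {xs = _ ∷ xs} (_ ∷ u)  {suc i} {suc j} eq = cong suc (lookup-injective u eq)

  split-at-first : ∀ {P : A → Set} → Decidable P → ∀ xs → Any P xs →
                   ∃[ pre ] ∃[ v ] ∃[ post ] xs ≡ pre ++ v ∷ post × P v × All (¬_ ∘′ P) pre
  split-at-first P? (x ∷ xs) any with P? x
  ... | yes px = [] , x , xs , refl , px , []
  split-at-first P? (x ∷ xs) (here px)  | no ¬px = ⊥-elim (¬px px)
  split-at-first P? (x ∷ xs) (there pxs) | no ¬px
    with pre , v , post , refl , pv , ¬pre ← split-at-first P? xs pxs =
    x ∷ pre , v , post , refl , pv , ¬px ∷ ¬pre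

  split-at-last : ∀ {P : A → Set} → Decidable P → ∀ xs → Any P xs →
                  ∃[ pre ] ∃[ v ] ∃[ post ] xs ≡ pre ++ v ∷ post × P v × All (¬_ ∘′ P) post
  split-at-last P? (x ∷ xs) any with any? P? xs
  ... | yes pxs with pre , v , post , refl , pv , ¬post ← split-at-last P? xs pxs =
    x ∷ pre , v , post , refl , pv , ¬post
  split-at-last P? (x ∷ xs) (here px)  | no ¬pxs = [] , x , xs , refl , px , All.¬Any⇒All¬ xs ¬pxs
  split-at-last P? (x ∷ xs) (there pxs) | no ¬pxs = ⊥-elim (¬pxs pxs)

for-distinct-pairs : ∀ {R : Fin 3 → Fin 3 → Set} → (∀ {i j} → R i j → R j i) →
                     R 0F 1F → R 0F 2F → R 1F 2F → ∀ i j → i ≢ j → R i j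
for-distinct-pairs sym r₀₁ r₀₂ r₁₂ = λ where
  0F 0F ne → ⊥-elim (ne refl)
  0F 1F _  → r₀₁
  0F 2F _  → r₀₂
  1F 0F _  → sym r₀₁
  1F 1F ne → ⊥-elim (ne refl)
  1F 2F _  → r₁₂
  2F 0F _  → sym r₀₂
  2F 1F _  → sym r₁₂
  2F 2F ne → ⊥-elim (ne refl)

-- Induced paths and walks

Vertex : Graph → Set
Vertex G = Fin (n G)

Edge : (G : Graph) → Vertex G → Vertex G → Set
Edge G x y = adj G x y ≡ true

module _ (G : Graph) where

  private
    V = Vertex G
    _~_ = Edge G
    variable
      a b s u v x y z : V
      p q xs ys : List V

  ~-sym : x ~ y → y ~ x
  ~-sym {x} {y} e = trans (Graph.sym G y x) e

  ~-irrefl : ¬ x ~ x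
  ~-irrefl {x} e with () ← trans (sym e) (irrefl G x)

  _~?_ : (x y : V) → Dec (x ~ y)
  x ~? y = adj G x y ≟ᵇ true

  Apart : V → V → Set
  Apart u v = u ≢ v × ¬ u ~ v

  apart-sym : Apart u v → Apart v u
  apart-sym (u≢v , u≁v) = (λ eq → u≢v (sym eq)) , (λ e → u≁v (~-sym e))

  Separated : List V → List V → Set
  Separated xs ys = ∀ {u v} → u ∈ xs → v ∈ ys → Apart u v

  separated-sym : Separated xs ys → Separated ys xs
  separated-sym sep mu mv = apart-sym (sep mv mu)

  record IsInducedPath (p : List V) : Set where
    field
      unique    : Unique p
      linked    : ∀ {x y} → Link p x y → x ~ y
      chordless : ∀ {x y} → x ∈ p → y ∈ p → x ~ y → PathEdge p x y

    pathEdge⇒~ : PathEdge p x y → x ~ y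
    pathEdge⇒~ = [ linked , (λ l → ~-sym (linked l)) ]′

  open IsInducedPath

  induced-[_] : ∀ x → IsInducedPath [ x ]
  induced-[ x ] .unique = [] ∷ []
  induced-[ x ] .linked (there ())
  induced-[ x ] .chordless (here refl) (here refl) e = ⊥-elim (~-irrefl e)

  induced-edge : x ~ y → IsInducedPath (x ∷ y ∷ [])
  induced-edge e .unique = ((λ { refl → ~-irrefl e }) ∷ []) ∷ [] ∷ []
  induced-edge e .linked here = e
  induced-edge e .linked (there (there ()))
  induced-edge e .chordless (here refl)         (there (here refl)) _ = inj₁ here
  induced-edge e .chordless (there (here refl)) (here refl)         _ = inj₂ here
  induced-edge e .chordless (here refl)         (here refl)         e′ = ⊥-elim (~-irrefl e′)
  induced-edge e .chordless (there (here refl)) (there (here refl)) e′ = ⊥-elim (~-irrefl e′)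

  induced-reverse : IsInducedPath p → IsInducedPath (reverse p)
  induced-reverse P .unique = unique-reverse (P .unique)
  induced-reverse P .linked l = ~-sym (P .linked (link-reverse⁻ l))
  induced-reverse P .chordless mx my e =
    Sum.swap (Sum.map link-reverse link-reverse (P .chordless (∈-reverse⁻ mx) (∈-reverse⁻ my) e))

  -- An induced path through s is two induced paths meeting at s whose
  -- remaining parts are separated.
  record SplitAt (xs : List V) (s : V) (ys : List V) : Set where
    field
      prefix    : IsInducedPath (xs ∷ʳ s)
      suffix    : IsInducedPath (s ∷ ys)
      separated : Separated xs ys

  pathEdge-++-∷⁻ : ∀ xs → PathEdge (xs ++ s ∷ ys) x y →
                   PathEdge (xs ∷ʳ s) x y ⊎ PathEdge (s ∷ ys) x y
  pathEdge-++-∷⁻ xs (inj₁ l) = Sum.map inj₁ inj₁ (link-++-∷⁻ xs l)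
  pathEdge-++-∷⁻ xs (inj₂ l) = Sum.map inj₂ inj₂ (link-++-∷⁻ xs l)

  split : ∀ xs → IsInducedPath (xs ++ s ∷ ys) → SplitAt xs s ys
  split {s = s} {ys = ys} xs P = record { prefix = prefix ; suffix = suffix ; separated = separated }
    where
    meet : x ∈ xs ∷ʳ s → x ∈ s ∷ ys → x ≡ s
    meet = unique-∷ʳ-meet xs (P .unique)

    s∉ys : s ∉ ys
    s∉ys = unique-∷⁻ (unique-++⁻ʳ xs (P .unique))

    prefix : IsInducedPath (xs ∷ʳ s)
    prefix .unique = unique-∷ʳ⁻ xs (P .unique)
    prefix .linked l = P .linked (link-∷ʳ⁺ xs l)
    prefix .chordless mx my e with pathEdge-++-∷⁻ xs (P .chordless (∈-∷ʳ⁺ xs mx) (∈-∷ʳ⁺ xs my) e)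
    ... | inj₁ pe = pe
    ... | inj₂ pe with refl ← meet mx (pathEdge-∈ˡ pe) | refl ← meet my (pathEdge-∈ʳ pe) =
      ⊥-elim (~-irrefl e)

    suffix : IsInducedPath (s ∷ ys)
    suffix .unique = unique-++⁻ʳ xs (P .unique)
    suffix .linked l = P .linked (link-++⁺ʳ xs l)
    suffix .chordless mx my e with pathEdge-++-∷⁻ xs (P .chordless (∈-++⁺ʳ xs mx) (∈-++⁺ʳ xs my) e)
    ... | inj₂ pe = pe
    ... | inj₁ pe with refl ← meet (pathEdge-∈ˡ pe) mx | refl ← meet (pathEdge-∈ʳ pe) my =
      ⊥-elim (~-irrefl e)

    separated : Separated xs ys
    separated mu mv .proj₁ refl = unique-++-disjoint xs (P .unique) mu (there mv)
    separated mu mv .proj₂ e with pathEdge-++-∷⁻ xs (P .chordless (∈-++⁺ˡ mu) (∈-++⁺ʳ xs (there mv)) e)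
    ... | inj₁ pe with refl ← meet (pathEdge-∈ʳ pe) (there mv) = s∉ys mv
    ... | inj₂ pe = unique-++-disjoint xs (P .unique) mu (pathEdge-∈ˡ pe)

  glue : ∀ xs → SplitAt xs s ys → IsInducedPath (xs ++ s ∷ ys)
  glue {s = s} {ys = ys} xs S = record { unique = unique′ ; linked = linked′ ; chordless = chordless′ }
    where
    open SplitAt S

    unique′ : Unique (xs ++ s ∷ ys)
    unique′ = Unique.++⁺ (unique-++⁻ˡ xs (prefix .unique)) (suffix .unique) λ where
      (mx , here refl) → unique-++-disjoint xs (prefix .unique) mx (here refl)
      (mx , there my)  → separated mx my .proj₁ refl

    linked′ : Link (xs ++ s ∷ ys) x y → x ~ y
    linked′ l = [ prefix .linked , suffix .linked ]′ (link-++-∷⁻ xs l)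

    pathEdge-∷ʳ⁺ : PathEdge (xs ∷ʳ s) x y → PathEdge (xs ++ s ∷ ys) x y
    pathEdge-∷ʳ⁺ = Sum.map (link-∷ʳ⁺ xs) (link-∷ʳ⁺ xs)

    pathEdge-++⁺ʳ : PathEdge (s ∷ ys) x y → PathEdge (xs ++ s ∷ ys) x y
    pathEdge-++⁺ʳ = Sum.map (link-++⁺ʳ xs) (link-++⁺ʳ xs)

    across : x ∈ xs ∷ʳ s → y ∈ s ∷ ys → x ~ y → PathEdge (xs ++ s ∷ ys) x y
    across mx my e with ∈-∷ʳ⁻ xs mx | my
    ... | inj₂ refl | _         = pathEdge-++⁺ʳ (suffix .chordless (here refl) my e)
    ... | inj₁ _    | here refl = pathEdge-∷ʳ⁺ (prefix .chordless mx (∈-++⁺ʳ xs (here refl)) e)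
    ... | inj₁ mx′  | there my′ = ⊥-elim (separated mx′ my′ .proj₂ e)

    chordless′ : x ∈ xs ++ s ∷ ys → y ∈ xs ++ s ∷ ys → x ~ y → PathEdge (xs ++ s ∷ ys) x y
    chordless′ mx my e with ∈-++-∷⁻ xs mx | ∈-++-∷⁻ xs my
    ... | inj₁ mx′ | inj₁ my′ = pathEdge-∷ʳ⁺ (prefix .chordless mx′ my′ e)
    ... | inj₂ mx′ | inj₂ my′ = pathEdge-++⁺ʳ (suffix .chordless mx′ my′ e)
    ... | inj₁ mx′ | inj₂ my′ = across mx′ my′ e
    ... | inj₂ mx′ | inj₁ my′ = Sum.swap (across my′ mx′ (~-sym e))


  induced-∷ : x ~ s → (∀ {v} → v ∈ ys → Apart x v) → IsInducedPath (s ∷ ys) →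
              IsInducedPath (x ∷ s ∷ ys)
  induced-∷ {x = x} e apart P = glue [ x ] record
    { prefix = induced-edge e ; suffix = P ; separated = λ { (here refl) → apart } }

  record Joined (p q : List V) : Set where
    field
      joined    : List V
      induced   : IsInducedPath joined
      head≡     : head joined ≡ head p
      last≡     : last joined ≡ last q
      from-p-q  : ∀ {v} → v ∈ joined → v ∈ p ⊎ v ∈ q
      p-shorter : length p ≤ length joined
      q-shorter : length q ≤ length joined

  join : IsInducedPath p → IsInducedPath q → last p ≡ just s → head q ≡ just s →
         (∀ {u v} → u ∈ p → v ∈ q → u ≢ s → v ≢ s → Apart u v) → Joined p q
  join {p = p} {s = s} pI qI lp hq sep with last-just p lp | head-just hq
  ... | ps , refl | qs , refl = record
    { joined    = ps ++ s ∷ qs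
    ; induced   = glue ps record
        { prefix = pI ; suffix = qI
        ; separated = λ mu mv → sep (∈-++⁺ˡ mu) (there mv)
                                    (λ { refl → unique-++-disjoint ps (pI .unique) mu (here refl) })
                                    (λ { refl → unique-∷⁻ (qI .unique) mv }) }
    ; head≡     = sym (head-∷ʳ ps)
    ; last≡     = last-++-∷ ps
    ; from-p-q  = ∈-++-∷⁻ ps
    ; p-shorter = subst₂ _≤_ (sym (length-++ ps)) (sym (length-++ ps)) (+-monoʳ-≤ (length ps) (s≤s z≤n))
    ; q-shorter = subst (length (s ∷ qs) ≤_) (sym (length-++ ps)) (m≤n+m _ (length ps))
    }

  induced-tail : IsInducedPath (a ∷ s ∷ ys) → IsInducedPath (s ∷ ys)
  induced-tail {a = a} P = SplitAt.suffix (split [ a ] P)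

  neighbour-on-path : IsInducedPath p → head p ≡ just a → last p ≡ just b → a ≢ b →
                      v ∈ p → ∃[ u ] u ∈ p × v ~ u
  neighbour-on-path {p = _ ∷ []}     _ refl refl a≢b _ = ⊥-elim (a≢b refl)
  neighbour-on-path {p = _ ∷ _ ∷ _} P _    _    _   m = go P m
    where
    go : IsInducedPath (a ∷ b ∷ xs) → v ∈ a ∷ b ∷ xs → ∃[ u ] u ∈ a ∷ b ∷ xs × v ~ u
    go P (here refl) = _ , there (here refl) , P .linked here
    go {xs = []} P (there (here refl)) = _ , here refl , ~-sym (P .linked here)
    go {xs = _ ∷ _} P (there m) with u , mu , e ← go (induced-tail P) m = u , there mu , e

  3≤length : IsInducedPath p → head p ≡ just a → last p ≡ just b → Apart a b → 3 ≤ length p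
  3≤length {p = _ ∷ []}        _ refl refl (a≢b , _) = ⊥-elim (a≢b refl)
  3≤length {p = _ ∷ _ ∷ []}    P refl refl (_ , a≁b) = ⊥-elim (a≁b (P .linked here))
  3≤length {p = _ ∷ _ ∷ _ ∷ _} _ _    _    _         = s≤s (s≤s (s≤s z≤n))

  Walk : V → V → Set
  Walk = Star _~_

  walk-vertices : Walk x y → List V
  walk-vertices {x = x} ε       = [ x ]
  walk-vertices {x = x} (_ ◅ w) = x ∷ walk-vertices w

  source-∈ : (w : Walk x y) → x ∈ walk-vertices w
  source-∈ ε       = here refl
  source-∈ (_ ◅ _) = here refl

  target-∈ : (w : Walk x y) → y ∈ walk-vertices w
  target-∈ ε       = here refl
  target-∈ (_ ◅ w) = there (target-∈ w)

  ∈-◅◅⁻ : (w₁ : Walk x y) (w₂ : Walk y z) →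
          v ∈ walk-vertices (w₁ ◅◅ w₂) → v ∈ walk-vertices w₁ ⊎ v ∈ walk-vertices w₂
  ∈-◅◅⁻ ε        w₂ m           = inj₂ m
  ∈-◅◅⁻ (_ ◅ w₁) w₂ (here refl) = inj₁ (here refl)
  ∈-◅◅⁻ (_ ◅ w₁) w₂ (there m)   = Sum.map₁ there (∈-◅◅⁻ w₁ w₂ m)

  ∈-revApp⁻ : (w₁ : Walk y x) (w₂ : Walk y z) →
              v ∈ walk-vertices (Star.revApp ~-sym w₁ w₂) →
              v ∈ walk-vertices w₁ ⊎ v ∈ walk-vertices w₂
  ∈-revApp⁻ ε        w₂ m = inj₂ m
  ∈-revApp⁻ (e ◅ w₁) w₂ m with ∈-revApp⁻ w₁ (~-sym e ◅ w₂) m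
  ... | inj₁ m₁         = inj₁ (there m₁)
  ... | inj₂ (here refl) = inj₁ (there (source-∈ w₁))
  ... | inj₂ (there m₂)  = inj₂ m₂

  ∈-reverse-walk⁻ : (w : Walk x y) → v ∈ walk-vertices (Star.reverse ~-sym w) → v ∈ walk-vertices w
  ∈-reverse-walk⁻ w m = [ id , (λ { (here refl) → source-∈ w }) ]′ (∈-revApp⁻ w ε m)

  -- Prepend the first vertex to the part of the shortcut tail after the last
  -- vertex of the tail equal or adjacent to it.
  shortcut : (w : Walk x y) →
             ∃[ p ] IsInducedPath p × head p ≡ just x × last p ≡ just y × p ⊆ walk-vertices w
  shortcut {x = x} ε = [ x ] , induced-[ x ] , refl , refl , id
  shortcut {x = x} {y = z} (e ◅ w) with shortcut w
  ... | p , P , hp , lp , p⊆ with head-just hp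
  ... | ps , refl with split-at-last (λ v → v ≟ x ⊎-dec x ~? v) p (here (inj₂ e))
  ... | pre , v , post , eq , near , ¬near = result near
    where
    suffix : IsInducedPath (v ∷ post)
    suffix = SplitAt.suffix (split pre (subst IsInducedPath eq P))

    suffix-last : last (v ∷ post) ≡ just z
    suffix-last = last-suffix pre eq lp

    suffix⊆ : v ∷ post ⊆ walk-vertices (e ◅ w)
    suffix⊆ m = there (p⊆ (subst (_ ∈_) (sym eq) (∈-++⁺ʳ pre m)))

    result : v ≡ x ⊎ x ~ v →
             ∃[ q ] IsInducedPath q × head q ≡ just x × last q ≡ just z × q ⊆ walk-vertices (e ◅ w)
    result (inj₁ refl) = v ∷ post , suffix , refl , suffix-last , suffix⊆
    result (inj₂ x~v) = x ∷ v ∷ post , induced-∷ x~v apart suffix , refl , suffix-last ,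
                        λ { (here refl) → here refl ; (there m) → suffix⊆ m }
      where
      apart : u ∈ post → Apart x u
      apart m = (λ { refl → All.lookup ¬near m (inj₁ refl) }) , (λ e′ → All.lookup ¬near m (inj₂ e′))

  WalkWithin : (V → Set) → V → V → Set
  WalkWithin X x y = Σ[ w ∈ Walk x y ] (∀ {v} → v ∈ walk-vertices w → X v)

  record Connected (X : V → Set) : Set where
    field
      root  : V
      root∈ : X root
      reach : ∀ {x} → X x → WalkWithin X root x

  walk-within : ∀ {X} → Connected X → X a → X b → WalkWithin X a b
  walk-within C xa xb with wa , wa⊆X ← Connected.reach C xa | wb , wb⊆X ← Connected.reach C xb =
    Star.reverse ~-sym wa ◅◅ wb ,
    λ m → [ (λ m₁ → wa⊆X (∈-reverse-walk⁻ wa m₁)) , wb⊆X ]′ (∈-◅◅⁻ (Star.reverse ~-sym wa) wb m)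

  record PathBetween (P Q W : V → Set) : Set where
    field
      path       : List V
      start end  : V
      induced    : IsInducedPath path
      path-head  : head path ≡ just start
      path-last  : last path ≡ just end
      start∈P    : P start
      end∈Q      : Q end
      only-start : ∀ {v} → v ∈ path → P v → v ≡ start
      only-end   : ∀ {v} → v ∈ path → Q v → v ≡ end
      path⊆W     : ∀ {v} → v ∈ path → W v

  -- Shortcut the walk, then cut at the last vertex in P and, after it, at the
  -- first vertex in Q.
  path-between : ∀ {P Q W : V → Set} → Decidable P → Decidable Q →
                 WalkWithin W x y → P x → Q y → PathBetween P Q W
  path-between {y = y} {P = P} {Q} P? Q? (w , w⊆W) px qy with shortcut w
  ... | p , pI , hp , lp , p⊆ with split-at-last P? p (lose (head-∈ hp) px)
  ... | pre , a , post , eq , pa , ¬P-post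
    with split-at-first Q? (a ∷ post) (lose (last-∈ (last-suffix pre eq lp)) qy)
  ... | pre′ , b , post′ , eq′ , qb , ¬Q-pre′ = record
      { path = pre′ ∷ʳ b ; start = a ; end = b
      ; induced = SplitAt.prefix (split pre′ (subst IsInducedPath eq′ a∷post-induced))
      ; path-head = trans (head-∷ʳ pre′) (cong head (sym eq′))
      ; path-last = last-∷ʳ pre′
      ; start∈P = pa ; end∈Q = qb
      ; only-start = λ m pv → only-start (in-a∷post m) pv
      ; only-end = λ m qv → [ (λ m′ → ⊥-elim (All.lookup ¬Q-pre′ m′ qv)) , id ]′ (∈-∷ʳ⁻ pre′ m)
      ; path⊆W = λ m → w⊆W (p⊆ (subst (_ ∈_) (sym eq) (∈-++⁺ʳ pre (in-a∷post m))))
      }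
    where
    a∷post-induced : IsInducedPath (a ∷ post)
    a∷post-induced = SplitAt.suffix (split pre (subst IsInducedPath eq pI))

    in-a∷post : v ∈ pre′ ∷ʳ b → v ∈ a ∷ post
    in-a∷post m = subst (_ ∈_) (sym eq′) (∈-∷ʳ⁺ pre′ m)

    only-start : v ∈ a ∷ post → P v → v ≡ a
    only-start (here eq) _  = eq
    only-start (there m) pv = ⊥-elim (All.lookup ¬P-post m pv)

  singleton-connected : Connected (_≡ x)
  singleton-connected {x} = record
    { root = x ; root∈ = refl ; reach = λ { refl → ε , λ { (here refl) → refl } } }

  ◅-within : ∀ {X} → u ~ x → WalkWithin X x y → WalkWithin (λ v → v ≡ u ⊎ X v) u y
  ◅-within e (w , w⊆X) = e ◅ w , λ { (here refl) → inj₁ refl ; (there m) → inj₂ (w⊆X m) }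

  ▻-within : ∀ {X} → WalkWithin X x y → y ~ u → WalkWithin (λ v → X v ⊎ v ≡ u) x u
  ▻-within (w , w⊆X) e = w ◅◅ (e ◅ ε) , λ m → [ inj₁ ∘′ w⊆X , last-two ]′ (∈-◅◅⁻ w (e ◅ ε) m)
    where
    last-two : v ∈ walk-vertices (e ◅ ε) → _
    last-two (here refl)         = inj₁ (w⊆X (target-∈ w))
    last-two (there (here refl)) = inj₂ refl

-- Claws and triangles

  Near : V → V → Set
  Near u v = u ≡ v ⊎ u ~ v

  near-sym : Near u v → Near v u
  near-sym = Sum.map sym ~-sym

  apart⇒¬near : Apart u v → ¬ Near u v
  apart⇒¬near (u≢v , u≁v) = [ u≢v , u≁v ]′

  record Attached (X : V → Set) (s : Fin 3 → V) : Set where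
    field
      connected : Connected X
      outside   : ∀ i → ¬ X (s i)
      apart     : ∀ i j → i ≢ j → Apart (s i) (s j)
      anchor    : Fin 3 → V
      anchor∈X  : ∀ i → X (anchor i)
      s~anchor  : ∀ i → s i ~ anchor i

  record Claw (X : V → Set) (s : Fin 3 → V) : Set where
    field
      centre          : V
      tail            : Fin 3 → List V
      leg-induced     : ∀ i → IsInducedPath (centre ∷ tail i)
      leg-last        : ∀ i → last (centre ∷ tail i) ≡ just (s i)
      centre-inside   : X centre ⊎ ∃[ j ] centre ≡ s j
      tail-inside     : ∀ i {v} → v ∈ tail i → X v ⊎ v ≡ s i
      tails-separated : ∀ i j → i ≢ j → Separated (tail i) (tail j)

  record Triangle (X : V → Set) (s : Fin 3 → V) : Set where
    field
      corner           : Fin 3 → V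
      tail             : Fin 3 → List V
      leg-induced      : ∀ i → IsInducedPath (corner i ∷ tail i)
      leg-last         : ∀ i → last (corner i ∷ tail i) ≡ just (s i)
      leg-inside       : ∀ i {v} → v ∈ corner i ∷ tail i → X v ⊎ v ≡ s i
      corners-adjacent : ∀ i j → i ≢ j → corner i ~ corner j
      tails-separated  : ∀ i j → i ≢ j → Separated (tail i) (corner j ∷ tail j)

  first∉ : IsInducedPath (a ∷ xs) → last (a ∷ xs) ≡ just b → b ∉ p → Separated xs p → a ∉ p
  first∉ {xs = []}    _ refl b∉p _   = b∉p
  first∉ {xs = _ ∷ _} P _    _   sep m = sep (here refl) m .proj₂ (~-sym (P .linked here))

  -- An induced path r … s₂ whose first vertex r is the only one touching p.
  record Reaching (X : V → Set) (s₂ : V) (p : List V) : Set where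
    field
      r            : V
      rs           : List V
      R-induced    : IsInducedPath (r ∷ rs)
      R-last       : last (r ∷ rs) ≡ just s₂
      R-inside     : ∀ {v} → v ∈ r ∷ rs → X v ⊎ v ≡ s₂
      rs-separated : Separated rs p
      r∉p          : r ∉ p
      r-sees-p     : Any (r ~_) p

  -- P = s₀ … x … s₁ is an induced path through X and r, the start of the
  -- reaching path from s₂, sees x first on P.
  module _ {X : V → Set} {s : Fin 3 → V} {pre mid : List V} {x : V}
           (P-induced : IsInducedPath (pre ++ x ∷ mid))
           (P-head : head (pre ++ x ∷ mid) ≡ just (s 0F))
           (P-last : last (pre ++ x ∷ mid) ≡ just (s 1F))
           (P-inside : ∀ {v} → v ∈ pre ++ x ∷ mid → v ≡ s 0F ⊎ X v ⊎ v ≡ s 1F)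
           (R : Reaching X (s 2F) (pre ++ x ∷ mid))
           (r~x : Reaching.r R ~ x)
           (r≁pre : ∀ {u} → u ∈ pre → ¬ Reaching.r R ~ u)
           where

    open Reaching R

    private
      P = pre ++ x ∷ mid

      P-split : SplitAt pre x mid
      P-split = split pre P-induced

    x∷mid-induced : IsInducedPath (x ∷ mid)
    x∷mid-induced = SplitAt.suffix P-split

    x∷mid-last : last (x ∷ mid) ≡ just (s 1F)
    x∷mid-last = last-suffix pre refl P-last

    x∷rev-pre-induced : IsInducedPath (x ∷ reverse pre)
    x∷rev-pre-induced = subst IsInducedPath (reverse-∷ʳ pre) (induced-reverse (SplitAt.prefix P-split))

    x∷rev-pre-last : last (x ∷ reverse pre) ≡ just (s 0F)
    x∷rev-pre-last = subst (λ q → last q ≡ just (s 0F)) (reverse-∷ʳ pre)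
                           (last-reverse (trans (head-∷ʳ pre) P-head))

    pre-inside : u ∈ pre → X u ⊎ u ≡ s 0F
    pre-inside m with P-inside (∈-++⁺ˡ m)
    ... | inj₁ eq        = inj₂ eq
    ... | inj₂ (inj₁ xu) = inj₁ xu
    ... | inj₂ (inj₂ refl) = ⊥-elim (unique-++-disjoint pre (P-induced .unique) m (last-∈ x∷mid-last))

    mid-inside : u ∈ mid → X u ⊎ u ≡ s 1F
    mid-inside m with P-inside (∈-++⁺ʳ pre (there m))
    ... | inj₂ xu = xu
    ... | inj₁ refl with refl ← unique-∷ʳ-meet pre (P-induced .unique)
                                  (head-∈ (trans (head-∷ʳ pre) P-head)) (there m)
                      = ⊥-elim (unique-∷⁻ (x∷mid-induced .unique) m)

    x-inside : ∀ {y ys} → mid ≡ y ∷ ys → X x ⊎ x ≡ s 0F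
    x-inside refl with P-inside (∈-++⁺ʳ pre (here refl))
    ... | inj₁ eq          = inj₂ eq
    ... | inj₂ (inj₁ xx)   = inj₁ xx
    ... | inj₂ (inj₂ refl) = ⊥-elim (unique-∷⁻ (x∷mid-induced .unique) (last-∈ x∷mid-last))

    rev-pre⊆P : reverse pre ⊆ P
    rev-pre⊆P m = ∈-++⁺ˡ {ys = x ∷ mid} (∈-reverse⁻ m)

    x∷rev-pre⊆P : x ∷ reverse pre ⊆ P
    x∷rev-pre⊆P (here refl) = ∈-++⁺ʳ pre (here refl)
    x∷rev-pre⊆P (there m)   = rev-pre⊆P m

    separated-from-r∷rs : ∀ {ys} → ys ⊆ P → (∀ {u} → u ∈ ys → ¬ r ~ u) → Separated ys (r ∷ rs)
    separated-from-r∷rs ys⊆P r≁ys mu (here refl) = (λ { refl → r∉p (ys⊆P mu) }) , (λ e → r≁ys mu (~-sym e))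
    separated-from-r∷rs ys⊆P r≁ys mu (there mv) = apart-sym (rs-separated mv (ys⊆P mu))

    separated-from-rs : ∀ {ys} → ys ⊆ P → Separated ys rs
    separated-from-rs ys⊆P mu mv = apart-sym (rs-separated mv (ys⊆P mu))

    rev-pre-separated-from-r∷rs : Separated (reverse pre) (r ∷ rs)
    rev-pre-separated-from-r∷rs = separated-from-r∷rs rev-pre⊆P (λ m → r≁pre (∈-reverse⁻ m))

    -- r sees only x on P: a claw centred at x.
    claw-at-x : (∀ {u} → u ∈ mid → ¬ r ~ u) → Claw X s
    claw-at-x r≁mid = record
      { centre = x
      ; tail = λ { 0F → reverse pre ; 1F → mid ; 2F → r ∷ rs }
      ; leg-induced = λ { 0F → x∷rev-pre-induced ; 1F → x∷mid-induced
                        ; 2F → induced-∷ (~-sym r~x) x-apart-R R-induced }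
      ; leg-last = λ { 0F → x∷rev-pre-last ; 1F → x∷mid-last ; 2F → R-last }
      ; centre-inside = centre-inside
      ; tail-inside = λ { 0F m → pre-inside (∈-reverse⁻ m) ; 1F → mid-inside ; 2F → R-inside }
      ; tails-separated = for-distinct-pairs separated-sym
          (λ mu mv → SplitAt.separated P-split (∈-reverse⁻ mu) mv)
          rev-pre-separated-from-r∷rs
          (separated-from-r∷rs (λ m → ∈-++⁺ʳ pre (there m)) r≁mid)
      }
      where
      x-apart-R : v ∈ rs → Apart x v
      x-apart-R mv = apart-sym (rs-separated mv (∈-++⁺ʳ pre (here refl)))

      centre-inside : X x ⊎ ∃[ j ] x ≡ s j
      centre-inside with P-inside (∈-++⁺ʳ pre (here refl))
      ... | inj₁ eq          = inj₂ (0F , eq)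
      ... | inj₂ (inj₁ xx)   = inj₁ xx
      ... | inj₂ (inj₂ eq)   = inj₂ (1F , eq)

    -- r sees x and its successor y on P and nothing after: a triangle.
    triangle : ∀ {y post} → mid ≡ y ∷ post → r ~ y → (∀ {u} → u ∈ post → ¬ r ~ u) → Triangle X s
    triangle {y} {post} refl r~y r≁post = record
      { corner = λ { 0F → x ; 1F → y ; 2F → r }
      ; tail = λ { 0F → reverse pre ; 1F → post ; 2F → rs }
      ; leg-induced = λ { 0F → x∷rev-pre-induced ; 1F → induced-tail x∷mid-induced ; 2F → R-induced }
      ; leg-last = λ { 0F → x∷rev-pre-last ; 1F → x∷mid-last ; 2F → R-last }
      ; leg-inside = λ where
          0F (here refl) → x-inside refl
          0F (there m)   → pre-inside (∈-reverse⁻ m)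
          1F m           → mid-inside m
          2F m           → R-inside m
      ; corners-adjacent = for-distinct-pairs ~-sym (x∷mid-induced .linked here) (~-sym r~x) (~-sym r~y)
      ; tails-separated = λ where
          0F 0F ne → ⊥-elim (ne refl)
          0F 1F _  → λ mu mv → SplitAt.separated P-split (∈-reverse⁻ mu) mv
          0F 2F _  → rev-pre-separated-from-r∷rs
          1F 0F _  → λ where
            mu (here refl) → apart-sym (SplitAt.separated (split [ x ] x∷mid-induced) (here refl) mu)
            mu (there mv)  → apart-sym (SplitAt.separated P-split (∈-reverse⁻ mv) (there mu))
          1F 1F ne → ⊥-elim (ne refl)
          1F 2F _  → separated-from-r∷rs (λ m → ∈-++⁺ʳ pre (there (there m))) r≁post
          2F 0F _  → separated-sym (separated-from-rs x∷rev-pre⊆P)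
          2F 1F _  → separated-sym (separated-from-rs (λ m → ∈-++⁺ʳ pre (there m)))
          2F 2F ne → ⊥-elim (ne refl)
      }

    -- r sees x and a later, non-consecutive vertex y last: a claw centred at r.
    claw-at-r : ∀ {z more y post} → mid ≡ z ∷ more ++ y ∷ post → r ~ y → (∀ {u} → u ∈ post → ¬ r ~ u) →
                Claw X s
    claw-at-r {z} {more} {y} {post} refl r~y r≁post = record
      { centre = r
      ; tail = λ { 0F → x ∷ reverse pre ; 1F → y ∷ post ; 2F → rs }
      ; leg-induced = λ where
          0F → induced-∷ r~x (λ m → apart-sym (rev-pre-separated-from-r∷rs m (here refl)))
                 x∷rev-pre-induced
          1F → induced-∷ r~y (λ m → apart-sym (separated-from-r∷rs post⊆P r≁post m (here refl)))
                 y∷post-induced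
          2F → R-induced
      ; leg-last = λ { 0F → x∷rev-pre-last ; 1F → last-suffix (x ∷ z ∷ more) refl x∷mid-last ; 2F → R-last }
      ; centre-inside = Sum.map₂ (2F ,_) (R-inside (here refl))
      ; tail-inside = λ where
          0F (here refl) → x-inside refl
          0F (there m)   → pre-inside (∈-reverse⁻ m)
          1F m           → mid-inside (there (∈-++⁺ʳ more m))
          2F m           → R-inside (there m)
      ; tails-separated = for-distinct-pairs separated-sym
          (λ where
            (here refl) mv → SplitAt.separated (split [ x ] x∷mid-induced) (here refl) (∈-++⁺ʳ more mv)
            (there mu)  mv → SplitAt.separated P-split (∈-reverse⁻ mu) (there (∈-++⁺ʳ more mv)))
          (separated-from-rs x∷rev-pre⊆P)
          (separated-from-rs y∷post⊆P)
      }
      where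
      y∷post⊆P : y ∷ post ⊆ P
      y∷post⊆P m = ∈-++⁺ʳ pre (there (there (∈-++⁺ʳ more m)))

      post⊆P : post ⊆ P
      post⊆P m = y∷post⊆P (there m)

      y∷post-induced : IsInducedPath (y ∷ post)
      y∷post-induced = SplitAt.suffix (split (x ∷ z ∷ more) x∷mid-induced)

    by-last-neighbour : Claw X s ⊎ Triangle X s
    by-last-neighbour with split-at-last (r ~?_) (x ∷ mid) (here r~x)
    ... | []           , y , post , refl , r~y , r≁post = inj₁ (claw-at-x (All.lookup r≁post))
    ... | _ ∷ []       , y , post , refl , r~y , r≁post = inj₂ (triangle refl r~y (All.lookup r≁post))
    ... | _ ∷ z ∷ more , y , post , refl , r~y , r≁post = inj₁ (claw-at-r refl r~y (All.lookup r≁post))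

  module _ {X : V → Set} {s : Fin 3 → V} (J : Attached X s) where
    open Attached J

    private
      P-walk : WalkWithin (λ v → v ≡ s 0F ⊎ X v ⊎ v ≡ s 1F) (s 0F) (s 1F)
      P-walk = ◅-within (s~anchor 0F)
                 (▻-within (walk-within connected (anchor∈X 0F) (anchor∈X 1F)) (~-sym (s~anchor 1F)))

      R-walk : WalkWithin (λ v → v ≡ s 2F ⊎ X v) (s 2F) (anchor 0F)
      R-walk = ◅-within (s~anchor 2F) (walk-within connected (anchor∈X 2F) (anchor∈X 0F))

    -- Walk from s₂ towards P and stop at the first vertex touching P.
    reaching : IsInducedPath p → head p ≡ just (s 0F) → last p ≡ just (s 1F) →
               (∀ {v} → v ∈ p → v ≡ s 0F ⊎ X v ⊎ v ≡ s 1F) → Reaching X (s 2F) p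
    reaching {p} pI hp lp p-inside
      with path-between (_≟ s 2F) (λ v → any? (v ~?_) p) R-walk refl
                        (lose (head-∈ hp) (~-sym (s~anchor 0F)))
    ... | record { path = q ; end = r ; induced = qI ; path-head = hq ; path-last = lq
                 ; start∈P = refl ; end∈Q = r-sees-p ; only-end = only-end ; path⊆W = q⊆W }
      with last-just q lq
    ... | ws , refl = record
      { r = r ; rs = reverse ws
      ; R-induced = R-induced
      ; R-last = R-last
      ; R-inside = λ m → Sum.swap (q⊆W (∈-reverse⁻ (subst (_ ∈_) (sym (reverse-∷ʳ ws)) m)))
      ; rs-separated = rs-separated
      ; r∉p = r∉p
      ; r-sees-p = r-sees-p
      }
      where
      R-induced : IsInducedPath (r ∷ reverse ws)
      R-induced = subst IsInducedPath (reverse-∷ʳ ws) (induced-reverse qI)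

      R-last : last (r ∷ reverse ws) ≡ just (s 2F)
      R-last = subst (λ q → last q ≡ just (s 2F)) (reverse-∷ʳ ws) (last-reverse hq)

      r∉ws : r ∉ ws
      r∉ws m = unique-++-disjoint ws (qI .unique) m (here refl)

      ws-blind : v ∈ ws → u ∈ p → ¬ v ~ u
      ws-blind mv mu e with refl ← only-end (∈-++⁺ˡ mv) (lose mu e) = r∉ws mv

      rs-separated : Separated (reverse ws) p
      rs-separated mv mu .proj₁ refl
        with u′ , mu′ , e ← neighbour-on-path pI hp lp (apart 0F 1F (λ ()) .proj₁) mu =
        ws-blind (∈-reverse⁻ mv) mu′ e
      rs-separated mv mu .proj₂ = ws-blind (∈-reverse⁻ mv) mu

      s₂∉p : s 2F ∉ p
      s₂∉p m with p-inside m
      ... | inj₁ eq          = apart 2F 0F (λ ()) .proj₁ eq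
      ... | inj₂ (inj₁ xs₂)  = outside 2F xs₂
      ... | inj₂ (inj₂ eq)   = apart 2F 1F (λ ()) .proj₁ eq

      r∉p : r ∉ p
      r∉p = first∉ R-induced R-last s₂∉p rs-separated

    claw-or-triangle : Claw X s ⊎ Triangle X s
    claw-or-triangle with shortcut (proj₁ P-walk)
    ... | p , pI , hp , lp , p⊆W with reaching pI hp lp (λ m → proj₂ P-walk (p⊆W m))
    ... | R with split-at-first (Reaching.r R ~?_) p (Reaching.r-sees-p R)
    ... | pre , x , mid , refl , r~x , r≁pre =
      by-last-neighbour pI hp lp (λ m → proj₂ P-walk (p⊆W m)) R r~x (All.lookup r≁pre)

  ClawContact : V → Fin 3 → Fin 3 → V → V → Set
  ClawContact c _ _ u v = u ≡ c ⊎ v ≡ c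

  TriangleContact : (Fin 3 → V) → Fin 3 → Fin 3 → V → V → Set
  TriangleContact t i j u v = u ≡ t i × v ≡ t j

  -- The common interface of claws and triangles used to assemble the three paths.
  record Junction (X : V → Set) (s : Fin 3 → V) : Set₁ where
    field
      apex           : Fin 3 → V
      leg            : Fin 3 → List V
      leg-induced    : ∀ i → IsInducedPath (leg i)
      leg-head       : ∀ i → head (leg i) ≡ just (apex i)
      leg-last       : ∀ i → last (leg i) ≡ just (s i)
      Central        : V → Set
      Contact        : Fin 3 → Fin 3 → V → V → Set
      leg-inside     : ∀ i {v} → v ∈ leg i → Central v ⊎ X v ⊎ v ≡ s i
      central-inside : ∀ {v} → Central v → X v ⊎ ∃[ j ] v ≡ s j
      centralˡ       : ∀ {i j u v} → Central u → Contact i j u v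
      centralʳ       : ∀ {i j u v} → Central v → Contact i j u v
      contact-sym    : ∀ {i j u v} → Contact i j u v → Contact j i v u
      legs-contact   : ∀ i j → i ≢ j → ∀ {u v} → u ∈ leg i → v ∈ leg j → Near u v → Contact i j u v

  claw⇒junction : ∀ {X s} → Claw X s → Junction X s
  claw⇒junction C = record
    { apex = λ _ → centre
    ; leg = λ i → centre ∷ tail i
    ; leg-induced = leg-induced
    ; leg-head = λ _ → refl
    ; leg-last = leg-last
    ; Central = _≡ centre
    ; Contact = ClawContact centre
    ; leg-inside = λ { i (here eq) → inj₁ eq ; i (there m) → inj₂ (tail-inside i m) }
    ; central-inside = λ { refl → centre-inside }
    ; centralˡ = inj₁
    ; centralʳ = inj₂
    ; contact-sym = Sum.swap
    ; legs-contact = legs-contact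
    }
    where
    open Claw C

    legs-contact : ∀ i j → i ≢ j → ∀ {u v} → u ∈ centre ∷ tail i → v ∈ centre ∷ tail j → Near u v →
                   ClawContact centre i j u v
    legs-contact i j _  (here eq)  _          _  = inj₁ eq
    legs-contact i j _  (there _)  (here eq)  _  = inj₂ eq
    legs-contact i j ne (there mu) (there mv) uv = ⊥-elim (apart⇒¬near (tails-separated i j ne mu mv) uv)

  triangle⇒junction : ∀ {X s} → Triangle X s → Junction X s
  triangle⇒junction T = record
    { apex = corner
    ; leg = λ i → corner i ∷ tail i
    ; leg-induced = leg-induced
    ; leg-head = λ _ → refl
    ; leg-last = leg-last
    ; Central = λ _ → ⊥
    ; Contact = TriangleContact corner
    ; leg-inside = λ i m → inj₂ (leg-inside i m)
    ; central-inside = λ ()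
    ; centralˡ = λ ()
    ; centralʳ = λ ()
    ; contact-sym = Product.swap
    ; legs-contact = legs-contact
    }
    where
    open Triangle T

    legs-contact : ∀ i j → i ≢ j → ∀ {u v} → u ∈ corner i ∷ tail i → v ∈ corner j ∷ tail j → Near u v →
                   TriangleContact corner i j u v
    legs-contact i j _  (here eq₁)  (here eq₂) _  = eq₁ , eq₂
    legs-contact i j ne (here refl) (there mv) uv =
      ⊥-elim (apart⇒¬near (tails-separated j i (λ eq → ne (sym eq)) mv (here refl)) (near-sym uv))
    legs-contact i j ne (there mu)  mv         uv = ⊥-elim (apart⇒¬near (tails-separated i j ne mu mv) uv)

-- Models of K*₂,₃

  record ThreePaths (a b : Fin 3 → V) (Contactᵃ Contactᵇ : Fin 3 → Fin 3 → V → V → Set) : Set where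
    field
      path      : Fin 3 → List V
      induced   : ∀ i → IsInducedPath (path i)
      path-head : ∀ i → head (path i) ≡ just (a i)
      path-last : ∀ i → last (path i) ≡ just (b i)
      long      : ∀ i → 3 ≤ length (path i)
      contact   : ∀ i j → i ≢ j → ∀ {u v} → u ∈ path i → v ∈ path j → Near u v →
                  Contactᵃ i j u v ⊎ Contactᵇ i j u v

  Touches : (V → Set) → V → Set
  Touches X v = ∃[ x ] X x × v ~ x

  touches? : ∀ {X} → Decidable X → Decidable (Touches X)
  touches? X? v = Fin.any? (λ x → X? x ×-dec v ~? x)

  record K23*-Model : Set₁ where
    field
      A B              : V → Set
      Y                : Fin 3 → V → Set
      A?               : Decidable A
      B?               : Decidable B
      A-connected      : Connected A
      B-connected      : Connected B
      Y-connected      : ∀ i → Connected (Y i)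
      A-B-disjoint     : ∀ {x} → A x → ¬ B x
      A-Y-disjoint     : ∀ i {x} → A x → ¬ Y i x
      B-Y-disjoint     : ∀ i {x} → B x → ¬ Y i x
      Y-Y-disjoint     : ∀ i j → i ≢ j → ∀ {x} → Y i x → ¬ Y j x
      A-B-anticomplete : ∀ {x y} → A x → B y → ¬ x ~ y
      Y-Y-anticomplete : ∀ i j → i ≢ j → ∀ {x y} → Y i x → Y j y → ¬ x ~ y
      Y-touches-A      : ∀ i → ∃[ y ] Y i y × Touches A y
      Y-touches-B      : ∀ i → ∃[ y ] Y i y × Touches B y
      Y-touches-once   : ∀ i {y} → Y i y → Touches A y → ¬ Touches B y
      Y-touches-apart  : ∀ i {y y′} → Y i y → Y i y′ → Touches A y → Touches B y′ → ¬ y ~ y′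

  module _ (M : K23*-Model) where
    open K23*-Model M

    Y-apart : ∀ i j → i ≢ j → Y i u → Y j v → Apart u v
    Y-apart i j ne yu yv = (λ { refl → Y-Y-disjoint i j ne yu yv }) , Y-Y-anticomplete i j ne yu yv

    -- Opaque: only the specification of arm is used, and unfolding it makes
    -- the goals below very large.
    opaque
      arm : ∀ i → PathBetween (Touches A) (Touches B) (Y i)
      arm i with Y-touches-A i | Y-touches-B i
      ... | y , yY , yA | y′ , y′Y , y′B =
        path-between (touches? A?) (touches? B?) (walk-within (Y-connected i) yY y′Y) yA y′B

    a-end b-end : Fin 3 → V
    a-end i = PathBetween.start (arm i)
    b-end i = PathBetween.end (arm i)

    a-end∈Y : ∀ i → Y i (a-end i)
    a-end∈Y i = PathBetween.path⊆W (arm i) (head-∈ (PathBetween.path-head (arm i)))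

    b-end∈Y : ∀ i → Y i (b-end i)
    b-end∈Y i = PathBetween.path⊆W (arm i) (last-∈ (PathBetween.path-last (arm i)))

    ends-apart : ∀ i → Apart (a-end i) (b-end i)
    ends-apart i = (λ eq → Y-touches-once i (a-end∈Y i) start∈P (subst (Touches B) (sym eq) end∈Q))
                , Y-touches-apart i (a-end∈Y i) (b-end∈Y i) start∈P end∈Q
      where open PathBetween (arm i)

    attached : ∀ {X} {r : Fin 3 → V} → Connected X → (∀ i {x} → X x → ¬ Y i x) →
               (∀ i → Y i (r i)) → (∀ i → Touches X (r i)) → Attached X r
    attached X-connected X-Y-disjoint r∈Y touches = record
      { connected = X-connected
      ; outside   = λ i x → X-Y-disjoint i x (r∈Y i)
      ; apart     = λ i j ne → Y-apart i j ne (r∈Y i) (r∈Y j)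
      ; anchor    = λ i → proj₁ (touches i)
      ; anchor∈X  = λ i → proj₁ (proj₂ (touches i))
      ; s~anchor  = λ i → proj₂ (proj₂ (touches i))
      }

    A-junction : Claw A a-end ⊎ Triangle A a-end
    A-junction =
      claw-or-triangle (attached A-connected A-Y-disjoint a-end∈Y (λ i → PathBetween.start∈P (arm i)))

    B-junction : Claw B b-end ⊎ Triangle B b-end
    B-junction =
      claw-or-triangle (attached B-connected B-Y-disjoint b-end∈Y (λ i → PathBetween.end∈Q (arm i)))

    arm-path : Fin 3 → List V
    arm-path i = PathBetween.path (arm i)

    arm-inside : ∀ i → v ∈ arm-path i → Y i v
    arm-inside i = PathBetween.path⊆W (arm i)

    -- One side of the model: A with the a-ends, or B with the b-ends.
    record Side : Set₁ where
      field
        X            : V → Set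
        end          : Fin 3 → V
        junction     : Junction X end
        X-Y-disjoint : ∀ i {x} → X x → ¬ Y i x
        end∈Y        : ∀ i → Y i (end i)
        only-end     : ∀ i {v} → v ∈ arm-path i → Touches X v → v ≡ end i
      open Junction junction public

      OnSide : V → Set
      OnSide v = X v ⊎ ∃[ j ] v ≡ end j

      on-side : ∀ i {v} → v ∈ leg i → OnSide v
      on-side i m with leg-inside i m
      ... | inj₁ c          = central-inside c
      ... | inj₂ (inj₁ xv)  = inj₁ xv
      ... | inj₂ (inj₂ eq)  = inj₂ (i , eq)

      side-arm-apart : ∀ i {u v} → OnSide u → u ≢ end i → v ∈ arm-path i → v ≢ end i → Apart u v
      side-arm-apart i (inj₁ xu) _ mv v≢end =
        (λ { refl → X-Y-disjoint i xu (arm-inside i mv) }) ,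
        (λ e → v≢end (only-end i mv (_ , xu , ~-sym e)))
      side-arm-apart i (inj₂ (j , refl)) u≢end mv _ with j ≟ i
      ... | yes refl = ⊥-elim (u≢end refl)
      ... | no j≢i   = Y-apart j i j≢i (end∈Y j) (arm-inside i mv)

      -- A leg vertex in X can only touch arm j at its end, which lies on leg j.
      leg-arm-contact : ∀ i j → i ≢ j → ∀ {u v} → u ∈ leg i → v ∈ arm-path j → Near u v →
                        Contact i j u v
      leg-arm-contact i j ne mu mv uv with leg-inside i mu
      ... | inj₁ c           = centralˡ c
      ... | inj₂ (inj₂ refl) = ⊥-elim (apart⇒¬near (Y-apart i j ne (end∈Y i) (arm-inside j mv)) uv)
      ... | inj₂ (inj₁ xu) with uv
      ...   | inj₁ refl = ⊥-elim (X-Y-disjoint j xu (arm-inside j mv))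
      ...   | inj₂ e with refl ← only-end j mv (_ , xu , ~-sym e) =
        legs-contact i j ne mu (last-∈ (leg-last j)) uv

    module _ (JA : Junction A a-end) (JB : Junction B b-end) where

      private
        A-side B-side : Side
        A-side = record
          { X = A ; end = a-end ; junction = JA ; X-Y-disjoint = A-Y-disjoint ; end∈Y = a-end∈Y
          ; only-end = λ i → PathBetween.only-start (arm i) }
        B-side = record
          { X = B ; end = b-end ; junction = JB ; X-Y-disjoint = B-Y-disjoint ; end∈Y = b-end∈Y
          ; only-end = λ i → PathBetween.only-end (arm i) }

        module SA = Side A-side
        module SB = Side B-side

      sides-apart : SA.OnSide u → SB.OnSide v → Apart u v
      sides-apart (inj₁ au) (inj₁ bv) = (λ { refl → A-B-disjoint au bv }) , A-B-anticomplete au bv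
      sides-apart (inj₁ au) (inj₂ (k , refl)) =
        (λ { refl → A-Y-disjoint k au (b-end∈Y k) }) ,
        (λ e → ends-apart k .proj₁
                 (sym (SA.only-end k (last-∈ (PathBetween.path-last (arm k))) (_ , au , ~-sym e))))
      sides-apart (inj₂ (j , refl)) (inj₁ bv) =
        (λ { refl → B-Y-disjoint j bv (a-end∈Y j) }) ,
        (λ e → ends-apart j .proj₁ (SB.only-end j (head-∈ (PathBetween.path-head (arm j))) (_ , bv , e)))
      sides-apart (inj₂ (j , refl)) (inj₂ (k , refl)) with j ≟ k
      ... | yes refl = ends-apart j
      ... | no j≢k   = Y-apart j k j≢k (a-end∈Y j) (b-end∈Y k)

      opposite-legs-contact : ∀ i j {u v} → u ∈ SA.leg i → v ∈ SB.leg j → Near u v →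
                              SA.Contact i j u v ⊎ SB.Contact i j u v
      opposite-legs-contact i j mu mv uv with SA.leg-inside i mu | SB.leg-inside j mv
      ... | inj₁ c | _      = inj₁ (SA.centralˡ c)
      ... | inj₂ _ | inj₁ c = inj₂ (SB.centralʳ c)
      ... | inj₂ _ | inj₂ _ = ⊥-elim (apart⇒¬near (sides-apart (SA.on-side i mu) (SB.on-side j mv)) uv)

      private
        first-half : ∀ i → Joined (SA.leg i) (arm-path i)
        first-half i = join (SA.leg-induced i) (PathBetween.induced (arm i)) (SA.leg-last i)
                         (PathBetween.path-head (arm i))
                         (λ mu mv u≢ v≢ → SA.side-arm-apart i (SA.on-side i mu) u≢ mv v≢)

        whole : ∀ i → Joined (Joined.joined (first-half i)) (reverse (SB.leg i))
        whole i = join (Joined.induced (first-half i)) (induced-reverse (SB.leg-induced i))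
                    (trans (Joined.last≡ (first-half i)) (PathBetween.path-last (arm i)))
                    (head-reverse (SB.leg i) (SB.leg-last i)) separated
          where
          separated : ∀ {u v} → u ∈ Joined.joined (first-half i) → v ∈ reverse (SB.leg i) →
                      u ≢ b-end i → v ≢ b-end i → Apart u v
          separated mu mv u≢ v≢ with Joined.from-p-q (first-half i) mu
          ... | inj₁ mu′ = sides-apart (SA.on-side i mu′) (SB.on-side i (∈-reverse⁻ mv))
          ... | inj₂ mu′ = apart-sym (SB.side-arm-apart i (SB.on-side i (∈-reverse⁻ mv)) v≢ mu′ u≢)

        path : Fin 3 → List V
        path i = Joined.joined (whole i)

        origin : ∀ i {v} → v ∈ path i → v ∈ SA.leg i ⊎ v ∈ arm-path i ⊎ v ∈ SB.leg i
        origin i m with Joined.from-p-q (whole i) m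
        ... | inj₂ m′ = inj₂ (inj₂ (∈-reverse⁻ m′))
        ... | inj₁ m′ = Sum.map₂ inj₁ (Joined.from-p-q (first-half i) m′)

        contact : ∀ i j → i ≢ j → ∀ {u v} → u ∈ path i → v ∈ path j → Near u v →
                  SA.Contact i j u v ⊎ SB.Contact i j u v
        contact i j ne mu mv uv with origin i mu | origin j mv
        ... | inj₁ mu′        | inj₁ mv′        = inj₁ (SA.legs-contact i j ne mu′ mv′ uv)
        ... | inj₁ mu′        | inj₂ (inj₁ mv′) = inj₁ (SA.leg-arm-contact i j ne mu′ mv′ uv)
        ... | inj₁ mu′        | inj₂ (inj₂ mv′) = opposite-legs-contact i j mu′ mv′ uv
        ... | inj₂ (inj₁ mu′) | inj₁ mv′        =
          inj₁ (SA.contact-sym (SA.leg-arm-contact j i (λ eq → ne (sym eq)) mv′ mu′ (near-sym uv)))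
        ... | inj₂ (inj₁ mu′) | inj₂ (inj₁ mv′) =
          ⊥-elim (apart⇒¬near (Y-apart i j ne (arm-inside i mu′) (arm-inside j mv′)) uv)
        ... | inj₂ (inj₁ mu′) | inj₂ (inj₂ mv′) =
          inj₂ (SB.contact-sym (SB.leg-arm-contact j i (λ eq → ne (sym eq)) mv′ mu′ (near-sym uv)))
        ... | inj₂ (inj₂ mu′) | inj₁ mv′        =
          Sum.map SA.contact-sym SB.contact-sym (opposite-legs-contact j i mv′ mu′ (near-sym uv))
        ... | inj₂ (inj₂ mu′) | inj₂ (inj₁ mv′) = inj₂ (SB.leg-arm-contact i j ne mu′ mv′ uv)
        ... | inj₂ (inj₂ mu′) | inj₂ (inj₂ mv′) = inj₂ (SB.legs-contact i j ne mu′ mv′ uv)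

      three-paths : ThreePaths SA.apex SB.apex SA.Contact SB.Contact
      three-paths = record
        { path      = path
        ; induced   = λ i → Joined.induced (whole i)
        ; path-head = λ i → trans (Joined.head≡ (whole i))
                                  (trans (Joined.head≡ (first-half i)) (SA.leg-head i))
        ; path-last = λ i → trans (Joined.last≡ (whole i)) (last-reverse (SB.leg-head i))
        ; long      = λ i → ≤-trans (3≤length (PathBetween.induced (arm i)) (PathBetween.path-head (arm i))
                                      (PathBetween.path-last (arm i)) (ends-apart i))
                                    (≤-trans (Joined.q-shorter (first-half i)) (Joined.p-shorter (whole i)))
        ; contact   = contact
        }

-- Thetas, pyramids and prisms

  reverse-paths : ∀ {a b C D} → ThreePaths a b C D → ThreePaths b a D C
  reverse-paths T = record
    { path      = λ i → reverse (path i)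
    ; induced   = λ i → induced-reverse (induced i)
    ; path-head = λ i → head-reverse (path i) (path-last i)
    ; path-last = λ i → last-reverse (path-head i)
    ; long      = λ i → subst (3 ≤_) (sym (length-reverse (path i))) (long i)
    ; contact   = λ i j ne mu mv uv → Sum.swap (contact i j ne (∈-reverse⁻ mu) (∈-reverse⁻ mv) uv)
    }
    where open ThreePaths T

  module InducedOn (L : List V) (L-unique : Unique L) {d : V} (d∈L : d ∈ L) where

    H : Graph
    H = record
      { n      = length L
      ; adj    = λ i j → adj G (lookup L i) (lookup L j)
      ; sym    = λ i j → Graph.sym G (lookup L i) (lookup L j)
      ; irrefl = λ i → irrefl G (lookup L i)
      }

    embed : Vertex H → V
    embed = lookup L

    H⊆G : InducedSubgraph H G
    H⊆G = record
      { emb     = embed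
      ; emb-inj = λ _ _ → lookup-injective L-unique
      ; emb-adj = λ _ _ → refl
      }

    -- Vertices outside L are sent to the junk value d.
    restrict : V → Vertex H
    restrict x with any? (x ≟_) L
    ... | yes m = Any.index m
    ... | no _  = Any.index d∈L

    embed-restrict : x ∈ L → embed (restrict x) ≡ x
    embed-restrict {x} m with any? (x ≟_) L
    ... | yes m′ = sym (Any.lookup-index m′)
    ... | no ¬m  = ⊥-elim (¬m m)

    restrict-embed : ∀ i → restrict (embed i) ≡ i
    restrict-embed i = lookup-injective L-unique (embed-restrict (∈-lookup i))

    embed-restrict-path : p ⊆ L → map embed (map restrict p) ≡ p
    embed-restrict-path {p} p⊆L =
      trans (sym (map-∘ p)) (map-id-local (All.tabulate (λ m → embed-restrict (p⊆L m))))

    restrict-path : p ⊆ L → IsInducedPath p → head p ≡ just a → last p ≡ just b →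
                    PathFromTo (map restrict p) (restrict a) (restrict b)
    restrict-path {p} p⊆L P hp lp =
      Unique.map⁻ (subst Unique (sym (embed-restrict-path p⊆L)) (P .unique)) ,
      trans (head-map p) (cong (Maybe.map restrict) hp) ,
      trans (last-map restrict p) (cong (Maybe.map restrict) lp)

    len-restrict : ∀ p → len (map restrict p) ≡ len p
    len-restrict p = cong (_∸ 1) (length-map restrict p)

    embed-∈ : p ⊆ L → ∀ {i} → i ∈ map restrict p → embed i ∈ p
    embed-∈ p⊆L m = subst (_ ∈_) (embed-restrict-path p⊆L) (∈-map⁺ embed m)

    restrict-pathEdge⁺ : PathEdge p x y → PathEdge (map restrict p) (restrict x) (restrict y)
    restrict-pathEdge⁺ = Sum.map (link-map⁺ restrict) (link-map⁺ restrict)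

    restrict-pathEdge⁻ : p ⊆ L → ∀ {i j} → PathEdge (map restrict p) i j → PathEdge p (embed i) (embed j)
    restrict-pathEdge⁻ p⊆L pe =
      subst (λ q → PathEdge q _ _) (embed-restrict-path p⊆L)
            (Sum.map (link-map⁺ embed) (link-map⁺ embed) pe)

  module Realise {a b C D} (T : ThreePaths a b C D) where
    open ThreePaths T

    private
      all-paths : List V
      all-paths = path 0F ++ path 1F ++ path 2F

      L : List V
      L = deduplicate _≟_ all-paths

      path⊆L : ∀ i → path i ⊆ L
      path⊆L 0F m = ∈-deduplicate⁺ _≟_ (∈-++⁺ˡ m)
      path⊆L 1F m = ∈-deduplicate⁺ _≟_ (∈-++⁺ʳ (path 0F) (∈-++⁺ˡ m))
      path⊆L 2F m = ∈-deduplicate⁺ _≟_ (∈-++⁺ʳ (path 0F) (∈-++⁺ʳ (path 1F) m))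

      L⊆paths : v ∈ L → ∃[ i ] v ∈ path i
      L⊆paths m with ∈-++⁻ (path 0F) (∈-deduplicate⁻ _≟_ all-paths m)
      ... | inj₁ m₀ = 0F , m₀
      ... | inj₂ m′ with ∈-++⁻ (path 1F) m′
      ...   | inj₁ m₁ = 1F , m₁
      ...   | inj₂ m₂ = 2F , m₂

    open InducedOn L (Deduplicate.deduplicate-! _≟_ all-paths) (path⊆L 0F (head-∈ (path-head 0F))) public
      using (H; H⊆G; embed; restrict)
    open InducedOn L (Deduplicate.deduplicate-! _≟_ all-paths) (path⊆L 0F (head-∈ (path-head 0F)))
      hiding (H; H⊆G; embed; restrict)

    P′ : Fin 3 → List (Vertex H)
    P′ i = map restrict (path i)

    P′-path : ∀ i → PathFromTo (P′ i) (restrict (a i)) (restrict (b i))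
    P′-path i = restrict-path (path⊆L i) (induced i) (path-head i) (path-last i)

    P′-long : ∀ i → 2 ≤ len (P′ i)
    P′-long i =
      subst (2 ≤_) (sym (len-restrict (path i))) (≤-trans (s≤s (s≤s z≤n)) (∸-monoˡ-≤ 1 (long i)))

    P′-cover : ∀ x → ∃[ i ] x ∈ P′ i
    P′-cover x with i , m ← L⊆paths (∈-lookup x) =
      i , subst (_∈ P′ i) (restrict-embed x) (∈-map⁺ restrict m)

    embed-∈-path : ∀ i {x} → x ∈ P′ i → embed x ∈ path i
    embed-∈-path i = embed-∈ (path⊆L i)

    restrict-∈-L : ∀ i {v} → v ∈ path i → embed (restrict v) ≡ v
    restrict-∈-L i m = embed-restrict (path⊆L i m)

    edge-on-path : ∀ i {x y} → embed x ∈ path i → embed y ∈ path i → Edge H x y →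
                   ∃[ i ] PathEdge (P′ i) x y
    edge-on-path i mx my e =
      i , subst₂ (PathEdge (P′ i)) (restrict-embed _) (restrict-embed _)
                 (restrict-pathEdge⁺ (induced i .chordless mx my e))

    pathEdge⇒edge : ∀ {x y} → ∃[ i ] PathEdge (P′ i) x y → Edge H x y
    pathEdge⇒edge (i , pe) = pathEdge⇒~ (induced i) (restrict-pathEdge⁻ (path⊆L i) pe)

    edge-cases : ∀ {x y} → Edge H x y →
                 (∃[ i ] PathEdge (P′ i) x y) ⊎
                 (∃[ i ] ∃[ j ] i ≢ j × embed x ∈ path i × embed y ∈ path j ×
                   (C i j (embed x) (embed y) ⊎ D i j (embed x) (embed y)))
    edge-cases {x} {y} e with P′-cover x | P′-cover y
    ... | i , mx | j , my with i ≟ j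
    ...   | yes refl = inj₁ (edge-on-path i (embed-∈-path i mx) (embed-∈-path i my) e)
    ...   | no i≢j   = inj₂ (i , j , i≢j , embed-∈-path i mx , embed-∈-path j my ,
                             contact i j i≢j (embed-∈-path i mx) (embed-∈-path j my) (inj₂ e))

    shared : ∀ i j {x} → i ≢ j → x ∈ P′ i → x ∈ P′ j →
             C i j (embed x) (embed x) ⊎ D i j (embed x) (embed x)
    shared i j i≢j mx my = contact i j i≢j (embed-∈-path i mx) (embed-∈-path j my) (inj₁ refl)

    restrict-≡ : ∀ {x v} → embed x ≡ v → x ≡ restrict v
    restrict-≡ {x} refl = sym (restrict-embed x)

    triEdge : ∀ {c : Fin 3 → V} → (∀ i → c i ∈ path i) → (∀ i j → i ≢ j → c i ~ c j) →
              ∀ {x y} → TriEdge (restrict ∘′ c) x y → Edge H x y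
    triEdge {c} c∈ c~c (i , j , i≢j , refl , refl) =
      subst₂ _~_ (sym (restrict-∈-L i (c∈ i))) (sym (restrict-∈-L j (c∈ j))) (c~c i j i≢j)

    on-path : ∀ {i x v} → embed x ≡ v → v ∈ path i → embed x ∈ path i
    on-path eq m = subst (_∈ path _) (sym eq) m

    edge-at-end : ∀ {i j x y v} → embed x ∈ path i → embed y ∈ path j → (∀ k → v ∈ path k) →
                  embed x ≡ v ⊎ embed y ≡ v → Edge H x y → ∃[ k ] PathEdge (P′ k) x y
    edge-at-end {j = j} _  my v∈ (inj₁ eq) e = edge-on-path j (on-path eq (v∈ j)) my e
    edge-at-end {i = i} mx _  v∈ (inj₂ eq) e = edge-on-path i mx (on-path eq (v∈ i)) e

  theta : ∀ {a b} → ThreePaths (λ _ → a) (λ _ → b) (ClawContact a) (ClawContact b) → Contains3PC G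
  theta {a} {b} T = H , H⊆G , inj₁ record
    { a = restrict a ; b = restrict b ; P = P′
    ; paths = P′-path ; long = P′-long
    ; disjoint = λ i j _ i≢j mx my →
        Sum.map [ restrict-≡ , restrict-≡ ]′ [ restrict-≡ , restrict-≡ ]′ (shared i j i≢j mx my)
    ; cover = P′-cover
    ; edges = λ _ _ → mk⇔ to pathEdge⇒edge
    }
    where
    open ThreePaths T
    open Realise T

    to : ∀ {x y} → Edge H x y → ∃[ i ] PathEdge (P′ i) x y
    to e with edge-cases e
    ... | inj₁ pe = pe
    ... | inj₂ (_ , _ , _ , mx , my , inj₁ at-a) = edge-at-end mx my (λ k → head-∈ (path-head k)) at-a e
    ... | inj₂ (_ , _ , _ , mx , my , inj₂ at-b) = edge-at-end mx my (λ k → last-∈ (path-last k)) at-b e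

  pyramid : ∀ {a c} → ThreePaths (λ _ → a) c (ClawContact a) (TriangleContact c) →
            (∀ i j → i ≢ j → c i ~ c j) → Contains3PC G
  pyramid {a} {c} T c~c = H , H⊆G , inj₂ (inj₂ record
    { a = restrict a ; b = restrict ∘′ c ; P = P′
    ; paths = P′-path
    ; long1 = λ i → ≤-trans (s≤s z≤n) (P′-long i)
    ; long2 = 0F , 1F , (λ ()) , P′-long 0F , P′-long 1F
    ; disjoint = disjoint
    ; cover = P′-cover
    ; edges = λ _ _ → mk⇔ to [ pathEdge⇒edge , triEdge (λ i → last-∈ (path-last i)) c~c ]′
    })
    where
    open ThreePaths T
    open Realise T

    disjoint : ∀ i j x → i ≢ j → x ∈ P′ i → x ∈ P′ j → x ≡ restrict a
    disjoint i j x i≢j mx my with shared i j i≢j mx my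
    ... | inj₁ at-a       = [ restrict-≡ , restrict-≡ ]′ at-a
    ... | inj₂ (eq₁ , eq₂) = ⊥-elim (~-irrefl (subst (c i ~_) (trans (sym eq₂) eq₁) (c~c i j i≢j)))

    to : ∀ {x y} → Edge H x y → (∃[ i ] PathEdge (P′ i) x y) ⊎ TriEdge (restrict ∘′ c) x y
    to e with edge-cases e
    ... | inj₁ pe = inj₁ pe
    ... | inj₂ (_ , _ , _ , mx , my , inj₁ at-a) =
      inj₁ (edge-at-end mx my (λ k → head-∈ (path-head k)) at-a e)
    ... | inj₂ (i , j , i≢j , _ , _ , inj₂ (eq₁ , eq₂)) =
      inj₂ (i , j , i≢j , restrict-≡ eq₁ , restrict-≡ eq₂)

  prism : ∀ {a b} → ThreePaths a b (TriangleContact a) (TriangleContact b) →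
          (∀ i j → i ≢ j → a i ~ a j) → (∀ i j → i ≢ j → b i ~ b j) → Contains3PC G
  prism {a} {b} T a~a b~b = H , H⊆G , inj₂ (inj₁ record
    { a = restrict ∘′ a ; b = restrict ∘′ b ; P = P′
    ; paths = P′-path
    ; lengths = inj₁ (λ i → ≤-trans (s≤s z≤n) (P′-long i))
    ; disjoint = disjoint
    ; cover = P′-cover
    ; edges = λ _ _ → mk⇔ to [ pathEdge⇒edge , [ triEdge (λ i → head-∈ (path-head i)) a~a
                                               , triEdge (λ i → last-∈ (path-last i)) b~b ]′ ]′
    })
    where
    open ThreePaths T
    open Realise T

    disjoint : ∀ i j x → i ≢ j → x ∈ P′ i → x ∈ P′ j → ⊥
    disjoint i j x i≢j mx my with shared i j i≢j mx my
    ... | inj₁ (eq₁ , eq₂) = ~-irrefl (subst (a i ~_) (trans (sym eq₂) eq₁) (a~a i j i≢j))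
    ... | inj₂ (eq₁ , eq₂) = ~-irrefl (subst (b i ~_) (trans (sym eq₂) eq₁) (b~b i j i≢j))

    to : ∀ {x y} → Edge H x y →
         (∃[ i ] PathEdge (P′ i) x y) ⊎ TriEdge (restrict ∘′ a) x y ⊎ TriEdge (restrict ∘′ b) x y
    to e with edge-cases e
    ... | inj₁ pe = inj₁ pe
    ... | inj₂ (i , j , i≢j , _ , _ , inj₁ (eq₁ , eq₂)) =
      inj₂ (inj₁ (i , j , i≢j , restrict-≡ eq₁ , restrict-≡ eq₂))
    ... | inj₂ (i , j , i≢j , _ , _ , inj₂ (eq₁ , eq₂)) =
      inj₂ (inj₂ (i , j , i≢j , restrict-≡ eq₁ , restrict-≡ eq₂))

  model⇒3PC : K23*-Model → Contains3PC G
  model⇒3PC M with A-junction M | B-junction M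
  ... | inj₁ ca | inj₁ cb = theta (three-paths M (claw⇒junction ca) (claw⇒junction cb))
  ... | inj₁ ca | inj₂ tb =
    pyramid (three-paths M (claw⇒junction ca) (triangle⇒junction tb)) (Triangle.corners-adjacent tb)
  ... | inj₂ ta | inj₁ cb =
    pyramid (reverse-paths (three-paths M (triangle⇒junction ta) (claw⇒junction cb)))
            (Triangle.corners-adjacent ta)
  ... | inj₂ ta | inj₂ tb =
    prism (three-paths M (triangle⇒junction ta) (triangle⇒junction tb))
          (Triangle.corners-adjacent ta) (Triangle.corners-adjacent tb)

-- Models along minor steps

module _ {G H : Graph} (S : InducedSubgraph H G) where
  open InducedSubgraph S

  private
    edge⁺ : ∀ {a b} → Edge H a b → Edge G (emb a) (emb b)
    edge⁺ {a} {b} e = trans (sym (emb-adj a b)) e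

    edge⁻ : ∀ {a b} → Edge G (emb a) (emb b) → Edge H a b
    edge⁻ {a} {b} e = trans (emb-adj a b) e

  Image : (Vertex H → Set) → Vertex G → Set
  Image X x = ∃[ z ] emb z ≡ x × X z

  image? : ∀ {X} → Decidable X → Decidable (Image X)
  image? X? x = Fin.any? (λ z → (emb z ≟ x) ×-dec X? z)

  image-within : ∀ {X a b} (w : Walk H a b) → (∀ {v} → v ∈ walk-vertices H w → X v) →
                 WalkWithin G (Image X) (emb a) (emb b)
  image-within ε       w⊆X = ε , λ { (here refl) → _ , refl , w⊆X (here refl) }
  image-within (e ◅ w) w⊆X with w′ , w′⊆ ← image-within w (λ m → w⊆X (there m)) =
    edge⁺ e ◅ w′ , λ { (here refl) → _ , refl , w⊆X (here refl) ; (there m) → w′⊆ m }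

  image-connected : ∀ {X} → Connected H X → Connected G (Image X)
  image-connected C = record
    { root  = emb root
    ; root∈ = root , refl , root∈
    ; reach = λ { (_ , refl , xz) → Product.uncurry image-within (reach xz) }
    }
    where open Connected C

  image-disjoint : ∀ {X Z} → (∀ {z} → X z → ¬ Z z) → ∀ {x} → Image X x → ¬ Image Z x
  image-disjoint disjoint (z , refl , xz) (z′ , eq , zz′) = disjoint xz (subst _ (emb-inj z′ z eq) zz′)

  image-anticomplete : ∀ {X Z} → (∀ {z z′} → X z → Z z′ → ¬ Edge H z z′) →
                       ∀ {x y} → Image X x → Image Z y → ¬ Edge G x y
  image-anticomplete anticomplete (z , refl , xz) (z′ , refl , zz′) e = anticomplete xz zz′ (edge⁻ e)

  touches-image : ∀ {X y} → Touches H X y → Touches G (Image X) (emb y)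
  touches-image (x , xx , e) = emb x , (x , refl , xx) , edge⁺ e

  image-touches : ∀ {X y} → Touches G (Image X) (emb y) → Touches H X y
  image-touches (_ , (x , refl , xx) , e) = x , xx , edge⁻ e

  model-image : K23*-Model H → K23*-Model G
  model-image M = record
    { A                = Image A
    ; B                = Image B
    ; Y                = λ i → Image (Y i)
    ; A?               = image? A?
    ; B?               = image? B?
    ; A-connected      = image-connected A-connected
    ; B-connected      = image-connected B-connected
    ; Y-connected      = λ i → image-connected (Y-connected i)
    ; A-B-disjoint     = image-disjoint A-B-disjoint
    ; A-Y-disjoint     = λ i → image-disjoint (A-Y-disjoint i)
    ; B-Y-disjoint     = λ i → image-disjoint (B-Y-disjoint i)
    ; Y-Y-disjoint     = λ i j i≢j → image-disjoint (Y-Y-disjoint i j i≢j)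
    ; A-B-anticomplete = image-anticomplete A-B-anticomplete
    ; Y-Y-anticomplete = λ i j i≢j → image-anticomplete (Y-Y-anticomplete i j i≢j)
    ; Y-touches-A      = λ i → let (y , yY , ta) = Y-touches-A i in emb y , (y , refl , yY) , touches-image ta
    ; Y-touches-B      = λ i → let (y , yY , tb) = Y-touches-B i in emb y , (y , refl , yY) , touches-image tb
    ; Y-touches-once   = λ { i (y , refl , yY) ta tb →
                             Y-touches-once i yY (image-touches ta) (image-touches tb) }
    ; Y-touches-apart  = λ { i (y , refl , yY) (y′ , refl , y′Y) ta tb e →
                             Y-touches-apart i yY y′Y (image-touches ta) (image-touches tb) (edge⁻ e) }
    }
    where open K23*-Model M

module _ {G H : Graph} (C : Contraction G H) where
  open Contraction C

  edge-down : ∀ {x y} → f x ≢ f y → Edge G x y → Edge H (f x) (f y)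
  edge-down f≢ e = Equivalence.from (f-adj _ _ f≢) (_ , _ , refl , refl , e)

  edge-up : ∀ {a b} → Edge H a b → ∃[ x ] ∃[ y ] f x ≡ a × f y ≡ b × Edge G x y
  edge-up {a} {b} e = Equivalence.to (f-adj a b (λ { refl → ~-irrefl H e })) e

  -- A fibre of f is a single vertex or the contracted edge.
  fibre-within : ∀ {X x y} → X (f x) → f x ≡ f y → WalkWithin G (X ∘′ f) x y
  fibre-within {X} {x} {y} xx eq with f-fibres x y eq
  ... | inj₁ refl                = ε , λ { (here refl) → xx }
  ... | inj₂ (inj₁ (refl , refl)) =
    uv-edge ◅ ε , λ { (here refl) → xx ; (there (here refl)) → subst X fu≡fv xx }
  ... | inj₂ (inj₂ (refl , refl)) =
    ~-sym G uv-edge ◅ ε , λ { (here refl) → xx ; (there (here refl)) → subst X (sym fu≡fv) xx }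

  lift-within : ∀ {X a b} (w : Walk H a b) → (∀ {v} → v ∈ walk-vertices H w → X v) →
                ∀ {x y} → f x ≡ a → f y ≡ b → WalkWithin G (X ∘′ f) x y
  lift-within {X} ε w⊆X refl fy = fibre-within {X} (w⊆X (here refl)) (sym fy)
  lift-within {X} (e ◅ w) w⊆X refl fy with x′ , y′ , fx′ , fy′ , e′ ← edge-up e
    with w₁ , w₁⊆ ← fibre-within {X} (w⊆X (here refl)) (sym fx′)
       | w₂ , w₂⊆ ← lift-within w (λ m → w⊆X (there m)) fy′ fy =
    w₁ ◅◅ (e′ ◅ w₂) , λ m → [ w₁⊆ , second-part ]′ (∈-◅◅⁻ G w₁ (e′ ◅ w₂) m)
    where
    second-part : ∀ {z} → z ∈ walk-vertices G (e′ ◅ w₂) → X (f z)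
    second-part (here refl) = subst X (sym fx′) (w⊆X (here refl))
    second-part (there m)   = w₂⊆ m

  preimage-connected : ∀ {X} → Connected H X → Connected G (X ∘′ f)
  preimage-connected Cn with r , fr ← f-onto (Connected.root Cn) = record
    { root  = r
    ; root∈ = subst _ (sym fr) (Connected.root∈ Cn)
    ; reach = λ xx → Product.uncurry lift-within (Connected.reach Cn xx) fr refl
    }

  preimage-touches : ∀ {X y} → ¬ X (f y) → Touches G (X ∘′ f) y → Touches H X (f y)
  preimage-touches {X} ¬xy (x , xx , e) = f x , xx , edge-down (λ eq → ¬xy (subst X (sym eq) xx)) e

  touches-preimage : ∀ {X Z : Vertex H → Set} {a} → Z a → Touches H X a →
                     ∃[ y ] Z (f y) × Touches G (X ∘′ f) y
  touches-preimage za (b , xb , e) with y , x , refl , refl , e′ ← edge-up e = y , za , x , xb , e′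

  model-preimage : K23*-Model H → K23*-Model G
  model-preimage M = record
    { A                = A ∘′ f
    ; B                = B ∘′ f
    ; Y                = λ i → Y i ∘′ f
    ; A?               = λ x → A? (f x)
    ; B?               = λ x → B? (f x)
    ; A-connected      = preimage-connected A-connected
    ; B-connected      = preimage-connected B-connected
    ; Y-connected      = λ i → preimage-connected (Y-connected i)
    ; A-B-disjoint     = A-B-disjoint
    ; A-Y-disjoint     = λ i → A-Y-disjoint i
    ; B-Y-disjoint     = λ i → B-Y-disjoint i
    ; Y-Y-disjoint     = λ i j i≢j → Y-Y-disjoint i j i≢j
    ; A-B-anticomplete = λ ax by e →
        A-B-anticomplete ax by (edge-down (λ eq → A-B-disjoint ax (subst B (sym eq) by)) e)
    ; Y-Y-anticomplete = λ i j i≢j yx yy e →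
        Y-Y-anticomplete i j i≢j yx yy (edge-down (λ eq → Y-Y-disjoint i j i≢j yx (subst (Y j) (sym eq) yy)) e)
    ; Y-touches-A      = λ i → let (_ , yY , ta) = Y-touches-A i in touches-preimage {Z = Y i} yY ta
    ; Y-touches-B      = λ i → let (_ , yY , tb) = Y-touches-B i in touches-preimage {Z = Y i} yY tb
    ; Y-touches-once   = λ i yY ta tb → Y-touches-once i yY (touches-A i yY ta) (touches-B i yY tb)
    ; Y-touches-apart  = touches-apart
    }
    where
    open K23*-Model M

    touches-A : ∀ i {y} → Y i (f y) → Touches G (A ∘′ f) y → Touches H A (f y)
    touches-A i yY = preimage-touches (λ ay → A-Y-disjoint i ay yY)

    touches-B : ∀ i {y} → Y i (f y) → Touches G (B ∘′ f) y → Touches H B (f y)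
    touches-B i yY = preimage-touches (λ by → B-Y-disjoint i by yY)

    -- If the edge y y′ is contracted, f y touches both A and B.
    touches-apart : ∀ i {y y′} → Y i (f y) → Y i (f y′) → Touches G (A ∘′ f) y → Touches G (B ∘′ f) y′ →
                    ¬ Edge G y y′
    touches-apart i {y} {y′} yY y′Y ta tb e with f y ≟ f y′
    ... | yes eq = Y-touches-once i yY (touches-A i yY ta) (subst (Touches H B) (sym eq) (touches-B i y′Y tb))
    ... | no f≢  = Y-touches-apart i yY y′Y (touches-A i yY ta) (touches-B i y′Y tb) (edge-down f≢ e)

minor-model : ∀ {G H} → InducedMinor H G → K23*-Model H → K23*-Model G
minor-model ε                   M = M
minor-model (delete S   ◅ steps) M = model-image S (minor-model steps M)
minor-model (contract C ◅ steps) M = model-preimage C (minor-model steps M)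

-- The inner vertices of the i-th path of K*₂,₃ are 2 + 3 i + k, k < 3.
node : Fin 3 → Fin 3 → Vertex K23*
node i k = 2 ↑ʳ combine i k

private
  InnerPath : Fin 3 → Vertex K23* → Set
  InnerPath i v = ∃[ k ] v ≡ node i k

  node-edge₀₁ : ∀ i → Edge K23* (node i 0F) (node i 1F)
  node-edge₀₁ = λ { 0F → refl ; 1F → refl ; 2F → refl }

  node-edge₁₂ : ∀ i → Edge K23* (node i 1F) (node i 2F)
  node-edge₁₂ = λ { 0F → refl ; 1F → refl ; 2F → refl }

  node₀~a : ∀ i → Edge K23* (node i 0F) (# 0)
  node₀~a = λ { 0F → refl ; 1F → refl ; 2F → refl }

  node₂~b : ∀ i → Edge K23* (node i 2F) (# 1)
  node₂~b = λ { 0F → refl ; 1F → refl ; 2F → refl }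

  inner-path-connected : ∀ i → Connected K23* (InnerPath i)
  inner-path-connected i = record { root = node i 0F ; root∈ = 0F , refl ; reach = reach }
    where
    reach : ∀ {v} → InnerPath i v → WalkWithin K23* (InnerPath i) (node i 0F) v
    reach (0F , refl) = ε , λ { (here refl) → 0F , refl }
    reach (1F , refl) = node-edge₀₁ i ◅ ε , λ where
      (here refl)         → 0F , refl
      (there (here refl)) → 1F , refl
    reach (2F , refl) = node-edge₀₁ i ◅ node-edge₁₂ i ◅ ε , λ where
      (here refl)                 → 0F , refl
      (there (here refl))         → 1F , refl
      (there (there (here refl))) → 2F , refl

  infix 4 _~?ᴷ_
  _~?ᴷ_ : (x y : Vertex K23*) → Dec (Edge K23* x y)
  _~?ᴷ_ = _~?_ K23*

  distinct-paths : ∀ i j → i ≢ j → ∀ k k′ → Apart K23* (node i k) (node j k′)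
  distinct-paths = from-yes (Fin.all? λ i → Fin.all? λ j → ¬? (i ≟ j) →-dec Fin.all? λ k → Fin.all? λ k′ →
                             ¬? (node i k ≟ node j k′) ×-dec ¬? (node i k ~?ᴷ node j k′))

  a∉paths : ∀ i k → # 0 ≢ node i k
  a∉paths = from-yes (Fin.all? λ i → Fin.all? λ k → ¬? ((# 0) ≟ node i k))

  b∉paths : ∀ i k → # 1 ≢ node i k
  b∉paths = from-yes (Fin.all? λ i → Fin.all? λ k → ¬? ((# 1) ≟ node i k))

  touches-once : ∀ i k → Edge K23* (node i k) (# 0) → ¬ Edge K23* (node i k) (# 1)
  touches-once = from-yes (Fin.all? λ i → Fin.all? λ k → (node i k ~?ᴷ (# 0)) →-dec ¬? (node i k ~?ᴷ (# 1)))

  touches-apart : ∀ i k k′ → Edge K23* (node i k) (# 0) → Edge K23* (node i k′) (# 1) →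
                  ¬ Edge K23* (node i k) (node i k′)
  touches-apart = from-yes (Fin.all? λ i → Fin.all? λ k → Fin.all? λ k′ →
                            (node i k ~?ᴷ (# 0)) →-dec (node i k′ ~?ᴷ (# 1)) →-dec
                            ¬? (node i k ~?ᴷ node i k′))

K23*-model : K23*-Model K23*
K23*-model = record
  { A                = _≡ # 0
  ; B                = _≡ # 1
  ; Y                = InnerPath
  ; A?               = _≟ # 0
  ; B?               = _≟ # 1
  ; A-connected      = singleton-connected K23*
  ; B-connected      = singleton-connected K23*
  ; Y-connected      = inner-path-connected
  ; A-B-disjoint     = λ { refl () }
  ; A-Y-disjoint     = λ { i refl (k , eq) → a∉paths i k eq }
  ; B-Y-disjoint     = λ { i refl (k , eq) → b∉paths i k eq }
  ; Y-Y-disjoint     = λ { i j i≢j (k , refl) (k′ , eq) → distinct-paths i j i≢j k k′ .proj₁ eq }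
  ; A-B-anticomplete = λ { refl refl () }
  ; Y-Y-anticomplete = λ { i j i≢j (k , refl) (k′ , refl) → distinct-paths i j i≢j k k′ .proj₂ }
  ; Y-touches-A      = λ i → node i 0F , (0F , refl) , # 0 , refl , node₀~a i
  ; Y-touches-B      = λ i → node i 2F , (2F , refl) , # 1 , refl , node₂~b i
  ; Y-touches-once   = λ { i (k , refl) (_ , refl , ea) (_ , refl , eb) → touches-once i k ea eb }
  ; Y-touches-apart  = λ { i (k , refl) (k′ , refl) (_ , refl , ea) (_ , refl , eb) →
                           touches-apart i k k′ ea eb }
  }

lemma2p3 : (G : Graph) → InducedMinor K23* G → Contains3PC G
lemma2p3 G K23*≼G = model⇒3PC G (minor-model K23*≼G K23*-model)
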